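{- Let $n\ge3$ and let $G_1$ and $G_2$ be the threshold graphs on $n$ vertices with binary strings $b_1=0^{n-2}1^2$ and $b_2=010^{n-3}1$, respectively. Then $G_1$ and $G_2$ are Seidel cospectral, i.e. their Seidel matrices have the same characteristic polynomial.
   Context: A threshold graph is built from a single vertex by repeatedly adding either an isolated vertex or a dominating vertex; its binary string $\alpha_1\cdots\alpha_n$ has $\alpha_1=0$ and, for $i\ge2$, $\alpha_i=0$ if the $i$-th vertex was added isolated and $\alpha_i=1$ if added dominating (adjacent to all earlier vertices). $0^s$ (resp. $1^t$) denotes a run of $s$ zeros (resp. $t$ ones). The Seidel matrix of a graph with adjacency matrix $A$ is $S=J-I-2A$, with $J$ the all-ones matrix. -}

module Defs where

open import Data.Bool using (Bool; true; false; if_then_else_; _∨_)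
open import Data.Nat as ℕ using (ℕ; zero; suc; _∸_; _<ᵇ_; _≤ᵇ_; _≡ᵇ_)
open import Data.Fin using (Fin; zero; suc; toℕ; punchIn)
open import Data.Integer using (ℤ; _+_; _-_; _*_; -_; 0ℤ; 1ℤ; -1ℤ; +_)
open import Data.List using (List; []; _∷_; map)
open import Relation.Binary.PropositionalEquality using (_≡_)

-- Polynomials over ℤ as coefficient lists (constant term first).

Poly : Set
Poly = List ℤ

_+ₚ_ : Poly → Poly → Poly
[]      +ₚ q       = q
(a ∷ p) +ₚ []      = a ∷ p
(a ∷ p) +ₚ (b ∷ q) = (a + b) ∷ (p +ₚ q)

scaleₚ : ℤ → Poly → Poly
scaleₚ c p = map (c *_) p

_*ₚ_ : Poly → Poly → Poly
[]      *ₚ q = []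
(a ∷ p) *ₚ q = scaleₚ a q +ₚ (0ℤ ∷ (p *ₚ q))

constₚ : ℤ → Poly
constₚ c = c ∷ []

Xₚ : Poly
Xₚ = 0ℤ ∷ 1ℤ ∷ []

coeff : Poly → ℕ → ℤ
coeff []      _       = 0ℤ
coeff (a ∷ p) zero    = a
coeff (a ∷ p) (suc k) = coeff p k

_≈ₚ_ : Poly → Poly → Set
p ≈ₚ q = ∀ k → coeff p k ≡ coeff q k

Matrix : Set → ℕ → Set
Matrix A n = Fin n → Fin n → A

sumFin : ∀ {n} → (Fin n → Poly) → Poly
sumFin {zero}  f = []
sumFin {suc n} f = f zero +ₚ sumFin (λ j → f (suc j))

sign : ℕ → Poly
sign zero          = constₚ 1ℤ
sign (suc zero)    = constₚ -1ℤ
sign (suc (suc k)) = sign k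

det : ∀ {n} → Matrix Poly n → Poly
det {zero}  M = constₚ 1ℤ
det {suc n} M =
  sumFin (λ j → (sign (toℕ j) *ₚ M zero j) *ₚ det (λ r c → M (suc r) (punchIn j c)))

δ : ∀ {n} → Fin n → Fin n → ℤ
δ zero    zero    = 1ℤ
δ zero    (suc j) = 0ℤ
δ (suc i) zero    = 0ℤ
δ (suc i) (suc j) = δ i j

charPoly : ∀ {n} → Matrix ℤ n → Poly
charPoly M = det (λ i j → (scaleₚ (δ i j) Xₚ) +ₚ constₚ (- M i j))

BinaryString : ℕ → Set
BinaryString n = Fin n → Bool

-- Adjacency matrix of the threshold graph with binary string α
-- (0-indexed): for i ≠ j, vertices i and j are adjacent iff the later
-- of the two, max(i,j), was added as a dominating vertex.
thresholdAdj : ∀ {n} → BinaryString n → Matrix ℤ n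
thresholdAdj α i j =
  if toℕ i <ᵇ toℕ j then (if α j then 1ℤ else 0ℤ)
  else if toℕ j <ᵇ toℕ i then (if α i then 1ℤ else 0ℤ)
  else 0ℤ

seidel : ∀ {n} → Matrix ℤ n → Matrix ℤ n
seidel A i j = (1ℤ - δ i j) - (+ 2) * A i j

SeidelCospectral : ∀ {n} → Matrix ℤ n → Matrix ℤ n → Set
SeidelCospectral A B = charPoly (seidel A) ≈ₚ charPoly (seidel B)

-- b₁ = 0^{n-2} 1^2 : positions n-2 and n-1 (0-indexed) are 1
b₁ : (n : ℕ) → BinaryString n
b₁ n i = (n ∸ 2) ≤ᵇ toℕ i

-- b₂ = 0 1 0^{n-3} 1 : positions 1 and n-1 (0-indexed) are 1
b₂ : (n : ℕ) → BinaryString n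
b₂ n i = (toℕ i ≡ᵇ 1) ∨ (toℕ i ≡ᵇ (n ∸ 1))

-- Write y = x + 1, so that x I − S = y I − J + 2 A. Peeling off vertex 0 (split
-- its diagonal entry y − 1 as y + (−1) and pivot on the −1) gives
--   det(x I − S_G) = y · det(x I − S_{G−0}) − det(x I − S_{G−0} + s sᵀ),
-- where s_v = ±1 records whether v is adjacent to 0. For G₁ = 0^{n−2} 1² the last
-- matrix is y I plus 2 on a single edge, so φ_n = y φ_{n−1} − y^{n−3} (y² − 4).
-- For G₂ = 0 1 0^{n−3} 1, Seidel switching at the last vertex leaves the single
-- edge {0, 1}, and one peeling (the last matrix is y I − 2 · star) gives
-- y^{n−1} (y − n + 1) − y^{n−3} (y² − 4 (n − 2)). Both equal
-- y^{n−3} (y³ − n y² + 4 (n − 2)).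

module Submission where

open import Defs
open import Algebra.Bundles using (CommutativeRing)
open import Data.Nat using (ℕ; _≤_)

module PolynomialRing where

  open import Data.Nat using (zero; suc)
  open import Data.Integer using (ℤ; _+_; _*_; 0ℤ; 1ℤ; -1ℤ; +_)
  import Data.Integer.Properties as ℤ
  open import Algebra.Properties.CommutativeSemigroup ℤ.+-commutativeSemigroup
    using () renaming (interchange to +-interchange)
  open import Data.Integer.Tactic.RingSolver using (solve-∀)
  open import Data.List using ([]; _∷_)
  open import Data.Product using (_,_)
  open import Level using (0ℓ)
  open import Relation.Binary.PropositionalEquality

  -- A record rather than the bare function type ≈ₚ, so that both polynomials
  -- can be inferred from a proof of equality.
  infix 4 _≃_
  record _≃_ (p q : Poly) : Set where
    constructor coeffwise
    field coeff-≡ : p ≈ₚ q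
  open _≃_ public

  ≃-refl : ∀ {p} → p ≃ p
  ≃-refl = coeffwise λ _ → refl

  ≃-sym : ∀ {p q} → p ≃ q → q ≃ p
  ≃-sym (coeffwise e) = coeffwise λ k → sym (e k)

  ≃-trans : ∀ {p q r} → p ≃ q → q ≃ r → p ≃ r
  ≃-trans (coeffwise e) (coeffwise f) = coeffwise λ k → trans (e k) (f k)

  ≃-reflexive : ∀ {p q} → p ≡ q → p ≃ q
  ≃-reflexive refl = ≃-refl

  ∷-cong : ∀ {a b p q} → a ≡ b → p ≃ q → (a ∷ p) ≃ (b ∷ q)
  ∷-cong e (coeffwise f) = coeffwise λ { zero → e ; (suc k) → f k }

  ∷-injectiveʳ : ∀ {a b p q} → (a ∷ p) ≃ (b ∷ q) → p ≃ q
  ∷-injectiveʳ (coeffwise e) = coeffwise λ k → e (suc k)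

  coeff-+ₚ : ∀ p q k → coeff (p +ₚ q) k ≡ coeff p k + coeff q k
  coeff-+ₚ []      q       k       = sym (ℤ.+-identityˡ _)
  coeff-+ₚ (a ∷ p) []      k       = sym (ℤ.+-identityʳ _)
  coeff-+ₚ (a ∷ p) (b ∷ q) zero    = refl
  coeff-+ₚ (a ∷ p) (b ∷ q) (suc k) = coeff-+ₚ p q k

  coeff-scaleₚ : ∀ a p k → coeff (scaleₚ a p) k ≡ a * coeff p k
  coeff-scaleₚ a []      k       = sym (ℤ.*-zeroʳ a)
  coeff-scaleₚ a (x ∷ p) zero    = refl
  coeff-scaleₚ a (x ∷ p) (suc k) = coeff-scaleₚ a p k

  negₚ : Poly → Poly
  negₚ = scaleₚ -1ℤ

  +ₚ-cong : ∀ {p p′ q q′} → p ≃ p′ → q ≃ q′ → (p +ₚ q) ≃ (p′ +ₚ q′)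
  +ₚ-cong {p} {p′} {q} {q′} (coeffwise e) (coeffwise f) = coeffwise λ k → begin
    coeff (p +ₚ q) k          ≡⟨ coeff-+ₚ p q k ⟩
    coeff p k + coeff q k     ≡⟨ cong₂ _+_ (e k) (f k) ⟩
    coeff p′ k + coeff q′ k   ≡⟨ coeff-+ₚ p′ q′ k ⟨
    coeff (p′ +ₚ q′) k        ∎
    where open ≡-Reasoning

  scaleₚ-cong : ∀ a {p q} → p ≃ q → scaleₚ a p ≃ scaleₚ a q
  scaleₚ-cong a {p} {q} (coeffwise e) = coeffwise λ k →
    trans (coeff-scaleₚ a p k) (trans (cong (a *_) (e k)) (sym (coeff-scaleₚ a q k)))

  +ₚ-assoc : ∀ p q r → ((p +ₚ q) +ₚ r) ≃ (p +ₚ (q +ₚ r))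
  +ₚ-assoc p q r = coeffwise at
    where
    at : ((p +ₚ q) +ₚ r) ≈ₚ (p +ₚ (q +ₚ r))
    at k
      rewrite coeff-+ₚ (p +ₚ q) r k | coeff-+ₚ p q k | coeff-+ₚ p (q +ₚ r) k | coeff-+ₚ q r k
      = ℤ.+-assoc (coeff p k) (coeff q k) (coeff r k)

  +ₚ-comm : ∀ p q → (p +ₚ q) ≃ (q +ₚ p)
  +ₚ-comm p q = coeffwise at
    where
    at : (p +ₚ q) ≈ₚ (q +ₚ p)
    at k rewrite coeff-+ₚ p q k | coeff-+ₚ q p k = ℤ.+-comm (coeff p k) (coeff q k)

  +ₚ-identityʳ : ∀ p → (p +ₚ []) ≃ p
  +ₚ-identityʳ p = coeffwise at
    where
    at : (p +ₚ []) ≈ₚ p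
    at k rewrite coeff-+ₚ p [] k = ℤ.+-identityʳ (coeff p k)

  +ₚ-middleFour : ∀ p q r s → ((p +ₚ q) +ₚ (r +ₚ s)) ≃ ((p +ₚ r) +ₚ (q +ₚ s))
  +ₚ-middleFour p q r s = coeffwise at
    where
    at : ((p +ₚ q) +ₚ (r +ₚ s)) ≈ₚ ((p +ₚ r) +ₚ (q +ₚ s))
    at k
      rewrite coeff-+ₚ (p +ₚ q) (r +ₚ s) k | coeff-+ₚ p q k | coeff-+ₚ r s k
            | coeff-+ₚ (p +ₚ r) (q +ₚ s) k | coeff-+ₚ p r k | coeff-+ₚ q s k
      = +-interchange (coeff p k) (coeff q k) (coeff r k) (coeff s k)

  negₚ-cong : ∀ {p q} → p ≃ q → negₚ p ≃ negₚ q
  negₚ-cong = scaleₚ-cong -1ℤ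

  +ₚ-inverseˡ : ∀ p → (negₚ p +ₚ p) ≃ []
  +ₚ-inverseˡ p = coeffwise at
    where
    at : (negₚ p +ₚ p) ≈ₚ []
    at k rewrite coeff-+ₚ (negₚ p) p k | coeff-scaleₚ -1ℤ p k =
      trans (cong (_+ coeff p k) (ℤ.-1*i≡-i (coeff p k))) (ℤ.+-inverseˡ (coeff p k))

  +ₚ-inverseʳ : ∀ p → (p +ₚ negₚ p) ≃ []
  +ₚ-inverseʳ p = ≃-trans (+ₚ-comm p (negₚ p)) (+ₚ-inverseˡ p)

  scaleₚ-distribˡ : ∀ a p q → scaleₚ a (p +ₚ q) ≃ (scaleₚ a p +ₚ scaleₚ a q)
  scaleₚ-distribˡ a p q = coeffwise at
    where
    at : scaleₚ a (p +ₚ q) ≈ₚ (scaleₚ a p +ₚ scaleₚ a q)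
    at k
      rewrite coeff-scaleₚ a (p +ₚ q) k | coeff-+ₚ (scaleₚ a p) (scaleₚ a q) k
            | coeff-scaleₚ a p k | coeff-scaleₚ a q k | coeff-+ₚ p q k
      = ℤ.*-distribˡ-+ a _ _

  scaleₚ-distribʳ : ∀ a b p → scaleₚ (a + b) p ≃ (scaleₚ a p +ₚ scaleₚ b p)
  scaleₚ-distribʳ a b p = coeffwise at
    where
    at : scaleₚ (a + b) p ≈ₚ (scaleₚ a p +ₚ scaleₚ b p)
    at k
      rewrite coeff-scaleₚ (a + b) p k | coeff-+ₚ (scaleₚ a p) (scaleₚ b p) k
            | coeff-scaleₚ a p k | coeff-scaleₚ b p k
      = ℤ.*-distribʳ-+ _ a b

  scaleₚ-zero : ∀ p → scaleₚ 0ℤ p ≃ []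
  scaleₚ-zero p = coeffwise (coeff-scaleₚ 0ℤ p)

  scaleₚ-scaleₚ : ∀ a b p → scaleₚ a (scaleₚ b p) ≃ scaleₚ (a * b) p
  scaleₚ-scaleₚ a b p = coeffwise at
    where
    at : scaleₚ a (scaleₚ b p) ≈ₚ scaleₚ (a * b) p
    at k
      rewrite coeff-scaleₚ a (scaleₚ b p) k | coeff-scaleₚ b p k | coeff-scaleₚ (a * b) p k
      = sym (ℤ.*-assoc a b _)

  *ₚ-zeroʳ : ∀ p → (p *ₚ []) ≃ []
  *ₚ-zeroʳ []      = ≃-refl
  *ₚ-zeroʳ (a ∷ p) = coeffwise λ { zero → refl ; (suc k) → coeff-≡ (*ₚ-zeroʳ p) k }

  *ₚ-zeroˡ : ∀ {p} → p ≃ [] → ∀ q → (p *ₚ q) ≃ []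
  *ₚ-zeroˡ {[]}    _               q = ≃-refl
  *ₚ-zeroˡ {a ∷ p} (coeffwise e) q = ≃-trans
    (+ₚ-cong (subst (λ b → scaleₚ b q ≃ []) (sym (e zero)) (scaleₚ-zero q)) ≃-refl)
    (coeffwise λ { zero → refl ; (suc k) → coeff-≡ (*ₚ-zeroˡ {p} (coeffwise λ k → e (suc k)) q) k })

  *ₚ-congˡ : ∀ {p p′} → p ≃ p′ → ∀ q → (p *ₚ q) ≃ (p′ *ₚ q)
  *ₚ-congˡ {[]}    {p′}     e q = ≃-sym (*ₚ-zeroˡ (≃-sym e) q)
  *ₚ-congˡ {a ∷ p} {[]}     e q = *ₚ-zeroˡ e q
  *ₚ-congˡ {a ∷ p} {a′ ∷ p′} e q = +ₚ-cong
    (coeffwise λ k → trans (coeff-scaleₚ a q k)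
      (trans (cong (_* coeff q k) (coeff-≡ e zero)) (sym (coeff-scaleₚ a′ q k))))
    (∷-cong refl (*ₚ-congˡ (∷-injectiveʳ e) q))

  *ₚ-congʳ : ∀ p {q q′} → q ≃ q′ → (p *ₚ q) ≃ (p *ₚ q′)
  *ₚ-congʳ []      e = ≃-refl
  *ₚ-congʳ (a ∷ p) e = +ₚ-cong (scaleₚ-cong a e) (∷-cong refl (*ₚ-congʳ p e))

  *ₚ-cong : ∀ {p p′ q q′} → p ≃ p′ → q ≃ q′ → (p *ₚ q) ≃ (p′ *ₚ q′)
  *ₚ-cong {p} {p′} {q} e f = ≃-trans (*ₚ-congˡ e q) (*ₚ-congʳ p′ f)

  *ₚ-distribˡ : ∀ p q r → (p *ₚ (q +ₚ r)) ≃ ((p *ₚ q) +ₚ (p *ₚ r))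
  *ₚ-distribˡ []      q r = ≃-refl
  *ₚ-distribˡ (a ∷ p) q r = ≃-trans
    (+ₚ-cong (scaleₚ-distribˡ a q r) (∷-cong (sym (ℤ.+-identityʳ 0ℤ)) (*ₚ-distribˡ p q r)))
    (+ₚ-middleFour (scaleₚ a q) (scaleₚ a r) (0ℤ ∷ (p *ₚ q)) (0ℤ ∷ (p *ₚ r)))

  *ₚ-distribʳ : ∀ r p q → ((p +ₚ q) *ₚ r) ≃ ((p *ₚ r) +ₚ (q *ₚ r))
  *ₚ-distribʳ r []      q       = ≃-refl
  *ₚ-distribʳ r (a ∷ p) []      = ≃-sym (+ₚ-identityʳ _)
  *ₚ-distribʳ r (a ∷ p) (b ∷ q) = ≃-trans
    (+ₚ-cong (scaleₚ-distribʳ a b r) (∷-cong (sym (ℤ.+-identityʳ 0ℤ)) (*ₚ-distribʳ r p q)))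
    (+ₚ-middleFour (scaleₚ a r) (scaleₚ b r) (0ℤ ∷ (p *ₚ r)) (0ℤ ∷ (q *ₚ r)))

  scaleₚ-*ₚ : ∀ a p q → scaleₚ a (p *ₚ q) ≃ (scaleₚ a p *ₚ q)
  scaleₚ-*ₚ a []      q = ≃-refl
  scaleₚ-*ₚ a (b ∷ p) q = ≃-trans (scaleₚ-distribˡ a (scaleₚ b q) (0ℤ ∷ (p *ₚ q)))
    (+ₚ-cong (scaleₚ-scaleₚ a b q) (∷-cong (ℤ.*-zeroʳ a) (scaleₚ-*ₚ a p q)))

  *ₚ-assoc : ∀ p q r → ((p *ₚ q) *ₚ r) ≃ (p *ₚ (q *ₚ r))
  *ₚ-assoc []      q r = ≃-refl
  *ₚ-assoc (a ∷ p) q r = ≃-trans (*ₚ-distribʳ r (scaleₚ a q) (0ℤ ∷ (p *ₚ q)))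
    (+ₚ-cong (≃-sym (scaleₚ-*ₚ a q r))
             (≃-trans (+ₚ-cong (scaleₚ-zero r) ≃-refl) (∷-cong refl (*ₚ-assoc p q r))))

  *ₚ-∷ʳ : ∀ p b q → (p *ₚ (b ∷ q)) ≃ (scaleₚ b p +ₚ (0ℤ ∷ (p *ₚ q)))
  *ₚ-∷ʳ []      b q = coeffwise λ { zero → refl ; (suc k) → refl }
  *ₚ-∷ʳ (a ∷ p) b q = ∷-cong (cong (_+ 0ℤ) (ℤ.*-comm a b))
    (≃-trans (+ₚ-cong ≃-refl (*ₚ-∷ʳ p b q))
    (≃-trans (≃-sym (+ₚ-assoc (scaleₚ a q) (scaleₚ b p) _))
    (≃-trans (+ₚ-cong (+ₚ-comm (scaleₚ a q) (scaleₚ b p)) ≃-refl)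
             (+ₚ-assoc (scaleₚ b p) (scaleₚ a q) _))))

  *ₚ-comm : ∀ p q → (p *ₚ q) ≃ (q *ₚ p)
  *ₚ-comm []      q = ≃-sym (*ₚ-zeroʳ q)
  *ₚ-comm (a ∷ p) q = ≃-trans (+ₚ-cong ≃-refl (∷-cong refl (*ₚ-comm p q))) (≃-sym (*ₚ-∷ʳ q a p))

  *ₚ-identityˡ : ∀ p → (constₚ 1ℤ *ₚ p) ≃ p
  *ₚ-identityˡ p = coeffwise at
    where
    coeff-[0] : ∀ k → coeff (0ℤ ∷ []) k ≡ 0ℤ
    coeff-[0] zero    = refl
    coeff-[0] (suc k) = refl

    at : (constₚ 1ℤ *ₚ p) ≈ₚ p
    at k
      rewrite coeff-+ₚ (scaleₚ 1ℤ p) (0ℤ ∷ []) k | coeff-scaleₚ 1ℤ p k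
      = trans (cong₂ _+_ (ℤ.*-identityˡ (coeff p k)) (coeff-[0] k)) (ℤ.+-identityʳ (coeff p k))

  *ₚ-identityʳ : ∀ p → (p *ₚ constₚ 1ℤ) ≃ p
  *ₚ-identityʳ p = ≃-trans (*ₚ-comm p (constₚ 1ℤ)) (*ₚ-identityˡ p)

  polyRing : CommutativeRing 0ℓ 0ℓ
  polyRing = record
    { Carrier = Poly ; _≈_ = _≃_ ; _+_ = _+ₚ_ ; _*_ = _*ₚ_ ; -_ = negₚ ; 0# = [] ; 1# = constₚ 1ℤ
    ; isCommutativeRing = record
      { isRing = record
        { +-isAbelianGroup = record
          { isGroup = record
            { isMonoid = record
              { isSemigroup = record
                { isMagma = record
                  { isEquivalence = record { refl = ≃-refl ; sym = ≃-sym ; trans = ≃-trans }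
                  ; ∙-cong = +ₚ-cong }
                ; assoc = +ₚ-assoc }
              ; identity = (λ _ → ≃-refl) , +ₚ-identityʳ }
            ; inverse = +ₚ-inverseˡ , +ₚ-inverseʳ
            ; ⁻¹-cong = negₚ-cong }
          ; comm = +ₚ-comm }
        ; *-cong = *ₚ-cong
        ; *-assoc = *ₚ-assoc
        ; *-identity = *ₚ-identityˡ , *ₚ-identityʳ
        ; distrib = *ₚ-distribˡ , *ₚ-distribʳ }
      ; *-comm = *ₚ-comm } }

  p+p≃0⇒p≃0 : ∀ p → (p +ₚ p) ≃ [] → p ≃ []
  p+p≃0⇒p≃0 p (coeffwise e) = coeffwise λ k →
    x+x≡0⇒x≡0 (coeff p k) (trans (sym (coeff-+ₚ p p k)) (e k))
    where
    2*x≡x+x : ∀ x → + 2 * x ≡ x + x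
    2*x≡x+x = solve-∀

    x+x≡0⇒x≡0 : ∀ x → x + x ≡ 0ℤ → x ≡ 0ℤ
    x+x≡0⇒x≡0 x h = ℤ.*-cancelˡ-≡ (+ 2) x 0ℤ
      (trans (2*x≡x+x x) (trans h (sym (ℤ.*-zeroʳ (+ 2)))))

module IndexArithmetic where

  open import Data.Bool using (true; false)
  open import Data.Bool.Properties using (T-≡)
  open import Data.Nat using (zero; suc; _<_; z≤n; s≤s; _≡ᵇ_)
  import Data.Nat.Properties as ℕ
  open import Data.Empty using (⊥-elim)
  open import Function.Base using (_∘_)
  open import Function.Bundles using (module Equivalence)
  open import Relation.Binary.PropositionalEquality

  punchInℕ : ℕ → ℕ → ℕ
  punchInℕ zero    c       = suc c
  punchInℕ (suc j) zero    = zero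
  punchInℕ (suc j) (suc c) = suc (punchInℕ j c)

  punchOutℕ : ℕ → ℕ → ℕ
  punchOutℕ zero    zero    = zero
  punchOutℕ zero    (suc k) = k
  punchOutℕ (suc l) zero    = zero
  punchOutℕ (suc l) (suc k) = suc (punchOutℕ l k)

  swapℕ : ℕ → ℕ → ℕ
  swapℕ zero    zero          = 1
  swapℕ zero    (suc zero)    = 0
  swapℕ zero    (suc (suc c)) = suc (suc c)
  swapℕ (suc j) zero          = zero
  swapℕ (suc j) (suc c)       = suc (swapℕ j c)

  punchInℕ-≤ : ∀ j c → punchInℕ j c ≤ suc c
  punchInℕ-≤ zero    c       = ℕ.≤-refl
  punchInℕ-≤ (suc j) zero    = z≤n
  punchInℕ-≤ (suc j) (suc c) = s≤s (punchInℕ-≤ j c)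

  punchInℕ-< : ∀ {n} j c → c < n → punchInℕ j c < suc n
  punchInℕ-< j c c<n = s≤s (ℕ.≤-trans (punchInℕ-≤ j c) c<n)

  punchInℕ-≢ : ∀ l c → punchInℕ l c ≢ l
  punchInℕ-≢ zero    c       ()
  punchInℕ-≢ (suc l) zero    ()
  punchInℕ-≢ (suc l) (suc c) e = punchInℕ-≢ l c (ℕ.suc-injective e)

  punchOutℕ-punchInℕ : ∀ l c → punchOutℕ l (punchInℕ l c) ≡ c
  punchOutℕ-punchInℕ zero    c       = refl
  punchOutℕ-punchInℕ (suc l) zero    = refl
  punchOutℕ-punchInℕ (suc l) (suc c) = cong suc (punchOutℕ-punchInℕ l c)

  punchInℕ-punchOutℕ : ∀ l k → l ≢ k → punchInℕ l (punchOutℕ l k) ≡ k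
  punchInℕ-punchOutℕ zero    zero    l≢k = ⊥-elim (l≢k refl)
  punchInℕ-punchOutℕ zero    (suc k) _   = refl
  punchInℕ-punchOutℕ (suc l) zero    _   = refl
  punchInℕ-punchOutℕ (suc l) (suc k) l≢k = cong suc (punchInℕ-punchOutℕ l k (l≢k ∘ cong suc))

  punchOutℕ-< : ∀ {n} l k → l ≢ k → k < suc n → l < suc n → punchOutℕ l k < n
  punchOutℕ-<         zero    zero    l≢k _         _         = ⊥-elim (l≢k refl)
  punchOutℕ-<         zero    (suc k) _   (s≤s k<n) _         = k<n
  punchOutℕ-< {zero}  (suc l) zero    _   _         (s≤s ())
  punchOutℕ-< {suc n} (suc l) zero    _   _         _         = s≤s z≤n
  punchOutℕ-< {zero}  (suc l) (suc k) _   (s≤s ())  _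
  punchOutℕ-< {suc n} (suc l) (suc k) l≢k (s≤s k<n) (s≤s l<n) =
    s≤s (punchOutℕ-< l k (l≢k ∘ cong suc) k<n l<n)

  punchInℕ-≢-punchOutℕ : ∀ l k c → c ≢ punchOutℕ l k → punchInℕ l c ≢ k
  punchInℕ-≢-punchOutℕ l k c c≢ e = c≢ (trans (sym (punchOutℕ-punchInℕ l c)) (cong (punchOutℕ l) e))

  swapℕ-self : ∀ j → swapℕ j j ≡ suc j
  swapℕ-self zero    = refl
  swapℕ-self (suc j) = cong suc (swapℕ-self j)

  swapℕ-suc : ∀ j → swapℕ j (suc j) ≡ j
  swapℕ-suc zero    = refl
  swapℕ-suc (suc j) = cong suc (swapℕ-suc j)

  swapℕ-< : ∀ j l → l < j → swapℕ j l ≡ l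
  swapℕ-< (suc j) zero    _         = refl
  swapℕ-< (suc j) (suc l) (s≤s l<j) = cong suc (swapℕ-< j l l<j)

  swapℕ-> : ∀ j l → suc j < l → swapℕ j l ≡ l
  swapℕ-> zero    (suc zero)    (s≤s ())
  swapℕ-> zero    (suc (suc l)) _          = refl
  swapℕ-> (suc j) (suc l)       (s≤s sj<l) = cong suc (swapℕ-> j l sj<l)

  swapℕ-punchInℕ-self : ∀ j c → swapℕ j (punchInℕ j c) ≡ punchInℕ (suc j) c
  swapℕ-punchInℕ-self zero    zero    = refl
  swapℕ-punchInℕ-self zero    (suc c) = refl
  swapℕ-punchInℕ-self (suc j) zero    = refl
  swapℕ-punchInℕ-self (suc j) (suc c) = cong suc (swapℕ-punchInℕ-self j c)

  swapℕ-punchInℕ-suc : ∀ j c → swapℕ j (punchInℕ (suc j) c) ≡ punchInℕ j c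
  swapℕ-punchInℕ-suc zero    zero    = refl
  swapℕ-punchInℕ-suc zero    (suc c) = refl
  swapℕ-punchInℕ-suc (suc j) zero    = refl
  swapℕ-punchInℕ-suc (suc j) (suc c) = cong suc (swapℕ-punchInℕ-suc j c)

  swapℕ-punchInℕ-≤ : ∀ j l c → l ≤ j → swapℕ (suc j) (punchInℕ l c) ≡ punchInℕ l (swapℕ j c)
  swapℕ-punchInℕ-≤ j       zero    c       _         = refl
  swapℕ-punchInℕ-≤ (suc j) (suc l) zero    _         = refl
  swapℕ-punchInℕ-≤ (suc j) (suc l) (suc c) (s≤s l≤j) = cong suc (swapℕ-punchInℕ-≤ j l c l≤j)

  swapℕ-punchInℕ-≥ : ∀ j l c → suc (suc j) ≤ l → swapℕ j (punchInℕ l c) ≡ punchInℕ l (swapℕ j c)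
  swapℕ-punchInℕ-≥ zero    (suc zero)    c             (s≤s ())
  swapℕ-punchInℕ-≥ zero    (suc (suc l)) zero          _         = refl
  swapℕ-punchInℕ-≥ zero    (suc (suc l)) (suc zero)    _         = refl
  swapℕ-punchInℕ-≥ zero    (suc (suc l)) (suc (suc c)) _         = refl
  swapℕ-punchInℕ-≥ (suc j) (suc l)       zero          _         = refl
  swapℕ-punchInℕ-≥ (suc j) (suc l)       (suc c)       (s≤s l≥) = cong suc (swapℕ-punchInℕ-≥ j l c l≥)

  ≡ᵇ-refl : ∀ r → (r ≡ᵇ r) ≡ true
  ≡ᵇ-refl zero    = refl
  ≡ᵇ-refl (suc r) = ≡ᵇ-refl r

  ≡ᵇ-≢ : ∀ r c → r ≢ c → (r ≡ᵇ c) ≡ false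
  ≡ᵇ-≢ r c r≢c with r ≡ᵇ c in r≡ᵇc
  ... | true  = ⊥-elim (r≢c (ℕ.≡ᵇ⇒≡ r c (Equivalence.from T-≡ r≡ᵇc)))
  ... | false = refl

-- Laplace expansion along row 0, for ℕ-indexed matrices: detℕ n M only looks at
-- the entries M r c with r, c < n.
module Determinant {c ℓ} (R : CommutativeRing c ℓ) where

  open import Data.Nat using (zero; suc; _<_; z≤n; s≤s; _≟_)
  import Data.Nat.Properties as ℕ
  open import Data.Empty using (⊥-elim)
  open import Data.Sum using (inj₁; inj₂)
  open import Relation.Binary.Definitions using (tri<; tri≈; tri>)
  open import Relation.Binary.PropositionalEquality as ≡ using (_≡_; _≢_)
  open import Relation.Nullary using (yes; no)
  open CommutativeRing R renaming (_+_ to _⊕_)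
  open import Algebra.Properties.Ring ring
    using (-‿involutive; -0#≈0#; -‿+-comm; -‿distribˡ-*; -‿distribʳ-*; x+x≈x⇒x≈0; -1*x≈-x)
  open import Algebra.Solver.Ring.NaturalCoefficients.Default commutativeSemiring
    using (solve; _:+_; _:*_; _:=_)
  open import Relation.Binary.Reasoning.Setoid setoid
  open IndexArithmetic

  Mat : Set c
  Mat = ℕ → ℕ → Carrier

  ∑ : ℕ → (ℕ → Carrier) → Carrier
  ∑ zero    f = 0#
  ∑ (suc n) f = f 0 ⊕ ∑ n (λ j → f (suc j))

  sgn : ℕ → Carrier
  sgn zero          = 1#
  sgn (suc zero)    = - 1#
  sgn (suc (suc k)) = sgn k

  minor : ℕ → Mat → Mat
  minor j M r c = M (suc r) (punchInℕ j c)

  mutual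
    detℕ : ℕ → Mat → Carrier
    detℕ zero    M = 1#
    detℕ (suc n) M = ∑ (suc n) (laplaceTerm n M)

    laplaceTerm : ℕ → Mat → ℕ → Carrier
    laplaceTerm n M j = (sgn j * M 0 j) * detℕ n (minor j M)

  sgn-suc : ∀ j → sgn (suc j) ≈ - sgn j
  sgn-suc zero          = refl
  sgn-suc (suc zero)    = sym (-‿involutive 1#)
  sgn-suc (suc (suc j)) = sgn-suc j

  ∑-cong : ∀ n {f g} → (∀ j → j < n → f j ≈ g j) → ∑ n f ≈ ∑ n g
  ∑-cong zero    h = refl
  ∑-cong (suc n) h = +-cong (h 0 (s≤s z≤n)) (∑-cong n (λ j j< → h (suc j) (s≤s j<)))

  ∑-zero : ∀ n f → (∀ j → j < n → f j ≈ 0#) → ∑ n f ≈ 0#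
  ∑-zero zero    f h = refl
  ∑-zero (suc n) f h =
    trans (+-cong (h 0 (s≤s z≤n)) (∑-zero n _ (λ j j< → h (suc j) (s≤s j<)))) (+-identityˡ 0#)

  ∑-linear : ∀ n a f g → ∑ n (λ j → f j ⊕ a * g j) ≈ ∑ n f ⊕ a * ∑ n g
  ∑-linear zero    a f g = sym (trans (+-identityˡ _) (zeroʳ a))
  ∑-linear (suc n) a f g = trans (+-cong refl (∑-linear n a (λ j → f (suc j)) (λ j → g (suc j))))
    (solve 5 (λ a f₀ g₀ F G → (f₀ :+ a :* g₀) :+ (F :+ a :* G) := (f₀ :+ F) :+ a :* (g₀ :+ G))
             refl a (f 0) (g 0) (∑ n λ j → f (suc j)) (∑ n λ j → g (suc j)))

  ∑-* : ∀ n a f → ∑ n (λ j → a * f j) ≈ a * ∑ n f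
  ∑-* zero    a f = sym (zeroʳ a)
  ∑-* (suc n) a f = trans (+-cong refl (∑-* n a (λ j → f (suc j)))) (sym (distribˡ a _ _))

  ∑-neg : ∀ n f → ∑ n (λ j → - f j) ≈ - ∑ n f
  ∑-neg zero    f = sym -0#≈0#
  ∑-neg (suc n) f = trans (+-cong refl (∑-neg n (λ j → f (suc j)))) (-‿+-comm _ _)

  ∑-swapℕ : ∀ n j f → suc j < n → ∑ n (λ l → f (swapℕ j l)) ≈ ∑ n f
  ∑-swapℕ (suc (suc n)) zero    f _        =
    solve 3 (λ a b c → a :+ (b :+ c) := b :+ (a :+ c)) refl _ _ _
  ∑-swapℕ (suc n)       (suc j) f (s≤s jn) = +-cong refl (∑-swapℕ n j (λ l → f (suc l)) jn)

  detℕ-cong< : ∀ n {A B} → (∀ r c → r < n → c < n → A r c ≈ B r c) → detℕ n A ≈ detℕ n B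
  detℕ-cong< zero    h = refl
  detℕ-cong< (suc n) h = ∑-cong (suc n) λ j j< →
    *-cong (*-cong (refl {sgn j}) (h 0 j (s≤s z≤n) j<))
           (detℕ-cong< n λ r c r< c< → h (suc r) (punchInℕ j c) (s≤s r<) (punchInℕ-< j c c<))

  detℕ-cong : ∀ n {A B} → (∀ r c → A r c ≈ B r c) → detℕ n A ≈ detℕ n B
  detℕ-cong n h = detℕ-cong< n (λ r c _ _ → h r c)

  detℕ-suc-linear : ∀ n A B C a →
    (∀ l → l < suc n → laplaceTerm n A l ≈ laplaceTerm n B l ⊕ a * laplaceTerm n C l) →
    detℕ (suc n) A ≈ detℕ (suc n) B ⊕ a * detℕ (suc n) C
  detℕ-suc-linear n A B C a h =
    trans (∑-cong (suc n) h) (∑-linear (suc n) a (laplaceTerm n B) (laplaceTerm n C))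

  s[x+ay]d≈sxd+a[syd] : ∀ s x y a d → (s * (x ⊕ a * y)) * d ≈ (s * x) * d ⊕ a * ((s * y) * d)
  s[x+ay]d≈sxd+a[syd] = solve 5
    (λ s x y a d → (s :* (x :+ a :* y)) :* d := (s :* x) :* d :+ a :* ((s :* y) :* d)) refl

  t[x+ay]≈tx+a[ty] : ∀ t x y a → t * (x ⊕ a * y) ≈ t * x ⊕ a * (t * y)
  t[x+ay]≈tx+a[ty] = solve 4 (λ t x y a → t :* (x :+ a :* y) := t :* x :+ a :* (t :* y)) refl

  withRow0 : (ℕ → Carrier) → Mat → Mat
  withRow0 u M zero    c = u c
  withRow0 u M (suc r) c = M (suc r) c

  unitRow : Carrier → ℕ → Carrier
  unitRow d zero    = d
  unitRow d (suc _) = 0#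

  detℕ-linearRow0 : ∀ n M u v a → (∀ c → M 0 c ≈ u c ⊕ a * v c) →
    detℕ (suc n) M ≈ detℕ (suc n) (withRow0 u M) ⊕ a * detℕ (suc n) (withRow0 v M)
  detℕ-linearRow0 n M u v a h0 = detℕ-suc-linear n M (withRow0 u M) (withRow0 v M) a λ l _ →
    trans (*-cong (*-cong refl (h0 l)) refl) (s[x+ay]d≈sxd+a[syd] _ _ _ _ _)

  detℕ-row0-diagonal : ∀ n A → (∀ c → c < n → A 0 (suc c) ≈ 0#)
    → detℕ (suc n) A ≈ A 0 0 * detℕ n (λ r c → A (suc r) (suc c))
  detℕ-row0-diagonal n A hz = begin
    (1# * A 0 0) * detℕ n (minor 0 A) ⊕ ∑ n (λ j → laplaceTerm n A (suc j))
      ≈⟨ +-cong (*-cong (*-identityˡ (A 0 0)) refl) (∑-zero n _ off-diagonal) ⟩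
    A 0 0 * detℕ n (minor 0 A) ⊕ 0#                  ≈⟨ +-identityʳ _ ⟩
    A 0 0 * detℕ n (λ r c → A (suc r) (suc c))       ∎
    where
    off-diagonal : ∀ j → j < n → laplaceTerm n A (suc j) ≈ 0#
    off-diagonal j j< = trans (*-cong (trans (*-cong refl (hz j j<)) (zeroʳ _)) refl) (zeroˡ _)

  detℕ-unitRow0 : ∀ n d M → detℕ (suc n) (withRow0 (unitRow d) M) ≈ d * detℕ n (λ r c → M (suc r) (suc c))
  detℕ-unitRow0 n d M = detℕ-row0-diagonal n (withRow0 (unitRow d) M) (λ _ _ → refl)

  detℕ-1 : ∀ M → detℕ 1 M ≈ M 0 0
  detℕ-1 M = trans (+-identityʳ _) (trans (*-identityʳ _) (*-identityˡ _))

  detℕ-2 : ∀ M → detℕ 2 M ≈ M 0 0 * M 1 1 ⊕ - (M 0 1 * M 1 0)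
  detℕ-2 M = begin
    (1# * M 0 0) * detℕ 1 (minor 0 M) ⊕ ((- 1# * M 0 1) * detℕ 1 (minor 1 M) ⊕ 0#)
      ≈⟨ +-cong (*-cong (*-identityˡ _) (detℕ-1 (minor 0 M))) (trans (+-identityʳ _) (*-cong refl (detℕ-1 (minor 1 M)))) ⟩
    M 0 0 * M 1 1 ⊕ (- 1# * M 0 1) * M 1 0
      ≈⟨ +-cong refl (trans (*-cong (-1*x≈-x _) refl) (sym (-‿distribˡ-* _ _))) ⟩
    M 0 0 * M 1 1 ⊕ - (M 0 1 * M 1 0)   ∎

  detℕ-scaleRow : ∀ n i A B a → i < n → (∀ c → A i c ≈ a * B i c)
    → (∀ r c → r ≢ i → A r c ≈ B r c) → detℕ n A ≈ a * detℕ n B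
  detℕ-scaleRow (suc n) zero A B a _ hi hr = trans (∑-cong (suc n) λ l _ → begin
    (sgn l * A 0 l) * detℕ n (minor l A)           ≈⟨ *-cong (*-cong refl (hi l)) (detℕ-cong n λ r c → hr (suc r) _ λ ()) ⟩
    (sgn l * (a * B 0 l)) * detℕ n (minor l B)
      ≈⟨ solve 4 (λ s a x d → (s :* (a :* x)) :* d := a :* ((s :* x) :* d)) refl _ _ _ _ ⟩
    a * laplaceTerm n B l                          ∎)
    (∑-* (suc n) a (laplaceTerm n B))
  detℕ-scaleRow (suc n) (suc i) A B a (s≤s i<) hi hr = trans (∑-cong (suc n) λ l _ → begin
    (sgn l * A 0 l) * detℕ n (minor l A)           ≈⟨ *-cong (*-cong refl (hr 0 l λ ())) (minor-scaled l) ⟩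
    (sgn l * B 0 l) * (a * detℕ n (minor l B))
      ≈⟨ solve 4 (λ s x a d → (s :* x) :* (a :* d) := a :* ((s :* x) :* d)) refl _ _ _ _ ⟩
    a * laplaceTerm n B l                          ∎)
    (∑-* (suc n) a (laplaceTerm n B))
    where
    minor-scaled : ∀ l → detℕ n (minor l A) ≈ a * detℕ n (minor l B)
    minor-scaled l = detℕ-scaleRow n i (minor l A) (minor l B) a i< (λ c → hi (punchInℕ l c))
      λ r c r≢i → hr (suc r) (punchInℕ l c) (λ e → r≢i (ℕ.suc-injective e))

  detℕ-linearColumn : ∀ n k (A B C : Mat) a → k < n → (∀ r → A r k ≈ B r k ⊕ a * C r k)
    → (∀ r c → c ≢ k → A r c ≈ B r c) → (∀ r c → c ≢ k → A r c ≈ C r c)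
    → detℕ n A ≈ detℕ n B ⊕ a * detℕ n C
  detℕ-linearColumn (suc n) k A B C a k< hk hB hC = detℕ-suc-linear n A B C a term
    where
    term : ∀ l → l < suc n → laplaceTerm n A l ≈ laplaceTerm n B l ⊕ a * laplaceTerm n C l
    term l l< with l ≟ k
    ... | yes ≡.refl = begin
      (sgn l * A 0 l) * detℕ n (minor l A)                ≈⟨ *-cong (*-cong refl (hk 0)) refl ⟩
      (sgn l * (B 0 l ⊕ a * C 0 l)) * detℕ n (minor l A)  ≈⟨ s[x+ay]d≈sxd+a[syd] _ _ _ _ _ ⟩
      (sgn l * B 0 l) * detℕ n (minor l A) ⊕ a * ((sgn l * C 0 l) * detℕ n (minor l A))
        ≈⟨ +-cong (*-cong refl (detℕ-cong n λ r c → hB (suc r) (punchInℕ l c) (punchInℕ-≢ l c)))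
                  (*-cong refl (*-cong refl (detℕ-cong n λ r c → hC (suc r) (punchInℕ l c) (punchInℕ-≢ l c)))) ⟩
      laplaceTerm n B l ⊕ a * laplaceTerm n C l           ∎
    ... | no l≢k = begin
      (sgn l * A 0 l) * detℕ n (minor l A)
        ≈⟨ *-cong refl minor-linear ⟩
      (sgn l * A 0 l) * (detℕ n (minor l B) ⊕ a * detℕ n (minor l C))
        ≈⟨ t[x+ay]≈tx+a[ty] _ _ _ _ ⟩
      (sgn l * A 0 l) * detℕ n (minor l B) ⊕ a * ((sgn l * A 0 l) * detℕ n (minor l C))
        ≈⟨ +-cong (*-cong (*-cong refl (hB 0 l l≢k)) refl)
                  (*-cong refl (*-cong (*-cong refl (hC 0 l l≢k)) refl)) ⟩
      laplaceTerm n B l ⊕ a * laplaceTerm n C l ∎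
      where
      k′ : ℕ
      k′ = punchOutℕ l k
      at-k′ : ∀ (M : Mat) r → minor l M r k′ ≡ M (suc r) k
      at-k′ M r = ≡.cong (M (suc r)) (punchInℕ-punchOutℕ l k l≢k)
      minor-linear : detℕ n (minor l A) ≈ detℕ n (minor l B) ⊕ a * detℕ n (minor l C)
      minor-linear = detℕ-linearColumn n k′ (minor l A) (minor l B) (minor l C) a
        (punchOutℕ-< l k l≢k k< l<)
        (λ r → trans (reflexive (at-k′ A r)) (trans (hk (suc r))
          (sym (+-cong (reflexive (at-k′ B r)) (*-cong refl (reflexive (at-k′ C r)))))))
        (λ r c c≢k′ → hB (suc r) (punchInℕ l c) (punchInℕ-≢-punchOutℕ l k c c≢k′))
        (λ r c c≢k′ → hC (suc r) (punchInℕ l c) (punchInℕ-≢-punchOutℕ l k c c≢k′))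

  detℕ-zeroColumn : ∀ n k A → k < n → (∀ r → A r k ≈ 0#) → detℕ n A ≈ 0#
  detℕ-zeroColumn n k A k< hz = x+x≈x⇒x≈0 _ (sym (trans
    (detℕ-linearColumn n k A A A 1# k< A-k≈A-k+1A-k (λ _ _ _ → refl) (λ _ _ _ → refl))
    (+-cong refl (*-identityˡ _))))
    where
    -- A zero column is itself plus itself, so linearity gives det A ≈ det A + det A.
    A-k≈A-k+1A-k : ∀ r → A r k ≈ A r k ⊕ 1# * A r k
    A-k≈A-k+1A-k r = begin
      A r k               ≈⟨ hz r ⟩
      0#                  ≈⟨ sym (+-identityˡ 0#) ⟩
      0# ⊕ 0#             ≈⟨ +-cong (sym (hz r)) (sym (trans (*-cong refl (hz r)) (zeroʳ 1#))) ⟩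
      A r k ⊕ 1# * A r k  ∎

  replaceColumn : ℕ → (ℕ → Carrier) → Mat → Mat
  replaceColumn k u B r c with c ≟ k
  ... | yes _ = u r
  ... | no  _ = B r c

  replaceColumn-≡ : ∀ k u B r → replaceColumn k u B r k ≡ u r
  replaceColumn-≡ k u B r with k ≟ k
  ... | yes _   = ≡.refl
  ... | no  k≢k = ⊥-elim (k≢k ≡.refl)

  replaceColumn-≢ : ∀ k u B r c → c ≢ k → replaceColumn k u B r c ≡ B r c
  replaceColumn-≢ k u B r c c≢k with c ≟ k
  ... | yes c≡k = ⊥-elim (c≢k c≡k)
  ... | no  _   = ≡.refl

  detℕ-scaleColumn : ∀ n k A B a → k < n → (∀ r → A r k ≈ a * B r k)
    → (∀ r c → c ≢ k → A r c ≈ B r c) → detℕ n A ≈ a * detℕ n B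
  detℕ-scaleColumn n k A B a k< hk hoff = begin
    detℕ n A                   ≈⟨ detℕ-linearColumn n k A B₀ B a k< column-k off-k hoff ⟩
    detℕ n B₀ ⊕ a * detℕ n B
      ≈⟨ +-cong (detℕ-zeroColumn n k B₀ k< λ r → reflexive (replaceColumn-≡ k _ B r)) refl ⟩
    0# ⊕ a * detℕ n B          ≈⟨ +-identityˡ _ ⟩
    a * detℕ n B               ∎
    where
    B₀ : Mat
    B₀ = replaceColumn k (λ _ → 0#) B
    column-k : ∀ r → A r k ≈ B₀ r k ⊕ a * B r k
    column-k r = trans (hk r) (sym (trans (+-cong (reflexive (replaceColumn-≡ k _ B r)) refl) (+-identityˡ _)))
    off-k : ∀ r c → c ≢ k → A r c ≈ B₀ r c
    off-k r c c≢k = trans (hoff r c c≢k) (reflexive (≡.sym (replaceColumn-≢ k _ B r c c≢k)))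

  switch : ℕ → Mat → Mat
  switch q M r c with r ≟ q | c ≟ q
  ... | yes _ | yes _ = M r c
  ... | yes _ | no  _ = - M r c
  ... | no  _ | yes _ = - M r c
  ... | no  _ | no  _ = M r c

  detℕ-switch : ∀ n q M → q < n → detℕ n (switch q M) ≈ detℕ n M
  detℕ-switch n q M q< = begin
    detℕ n (switch q M)         ≈⟨ detℕ-scaleRow n q (switch q M) N (- 1#) q< row-q off-q ⟩
    - 1# * detℕ n N             ≈⟨ *-cong refl (detℕ-scaleColumn n q N M (- 1#) q< column-q off-column-q) ⟩
    - 1# * (- 1# * detℕ n M)    ≈⟨ trans (-1*x≈-x _) (-‿cong (-1*x≈-x _)) ⟩
    - - detℕ n M                ≈⟨ -‿involutive _ ⟩
    detℕ n M                    ∎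
    where
    N : Mat
    N = replaceColumn q (λ r → - M r q) M

    column-q : ∀ r → N r q ≈ - 1# * M r q
    column-q r = trans (reflexive (replaceColumn-≡ q _ M r)) (sym (-1*x≈-x _))

    off-column-q : ∀ r c → c ≢ q → N r c ≈ M r c
    off-column-q r c c≢q = reflexive (replaceColumn-≢ q _ M r c c≢q)

    row-q : ∀ c → switch q M q c ≈ - 1# * N q c
    row-q c with q ≟ q | c ≟ q
    ... | no q≢q | _        = ⊥-elim (q≢q ≡.refl)
    ... | yes _  | yes ≡.refl = trans (sym (-‿involutive _)) (sym (-1*x≈-x _))
    ... | yes _  | no _     = sym (-1*x≈-x _)

    off-q : ∀ r c → r ≢ q → switch q M r c ≈ N r c
    off-q r c r≢q with r ≟ q | c ≟ q
    ... | yes r≡q | _        = ⊥-elim (r≢q r≡q)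
    ... | no _    | yes ≡.refl = refl
    ... | no _    | no _     = refl

  detℕ-swapAdjacentColumns : ∀ n j (A B : Mat) → suc j < n →
    (∀ r c → A r c ≈ B r (swapℕ j c)) → detℕ n A ≈ - detℕ n B
  detℕ-swapAdjacentColumns (suc n) j A B jn h = begin
    ∑ (suc n) (laplaceTerm n A)                      ≈⟨ ∑-cong (suc n) term ⟩
    ∑ (suc n) (λ l → - laplaceTerm n B (swapℕ j l))  ≈⟨ ∑-neg (suc n) (λ l → laplaceTerm n B (swapℕ j l)) ⟩
    - ∑ (suc n) (λ l → laplaceTerm n B (swapℕ j l))  ≈⟨ -‿cong (∑-swapℕ (suc n) j (laplaceTerm n B) jn) ⟩
    - ∑ (suc n) (laplaceTerm n B)                    ∎
    where
    A≈B : ∀ r c c′ → swapℕ j c ≡ c′ → A r c ≈ B r c′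
    A≈B r c c′ e = trans (h r c) (reflexive (≡.cong (B r) e))

    -- Away from columns j and j + 1 the minors are again related by an adjacent swap.
    fixed : ∀ l → swapℕ j l ≡ l → detℕ n (minor l A) ≈ - detℕ n (minor l B) →
            laplaceTerm n A l ≈ - laplaceTerm n B (swapℕ j l)
    fixed l e minor-swap = begin
      (sgn l * A 0 l) * detℕ n (minor l A)       ≈⟨ *-cong (*-cong refl (A≈B 0 l l e)) minor-swap ⟩
      (sgn l * B 0 l) * - detℕ n (minor l B)     ≈⟨ -‿distribʳ-* _ _ ⟨
      - laplaceTerm n B l                        ≈⟨ reflexive (≡.cong (λ l′ → - laplaceTerm n B l′) (≡.sym e)) ⟩
      - laplaceTerm n B (swapℕ j l)              ∎

    -- Columns j and j + 1 exchange their expansion terms, with opposite signs.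
    exchanged : ∀ l l′ → swapℕ j l ≡ l′ → sgn l ≈ - sgn l′ →
                (∀ r c → A (suc r) (punchInℕ l c) ≈ B (suc r) (punchInℕ l′ c)) →
                laplaceTerm n A l ≈ - laplaceTerm n B (swapℕ j l)
    exchanged l l′ e sgn≈ minors≈ = begin
      (sgn l * A 0 l) * detℕ n (minor l A)        ≈⟨ *-cong (*-cong sgn≈ (A≈B 0 l l′ e)) (detℕ-cong n minors≈) ⟩
      (- sgn l′ * B 0 l′) * detℕ n (minor l′ B)   ≈⟨ *-cong (-‿distribˡ-* _ _) refl ⟨
      - (sgn l′ * B 0 l′) * detℕ n (minor l′ B)   ≈⟨ -‿distribˡ-* _ _ ⟨
      - laplaceTerm n B l′                        ≈⟨ reflexive (≡.cong (λ l″ → - laplaceTerm n B l″) (≡.sym e)) ⟩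
      - laplaceTerm n B (swapℕ j l)               ∎

    term : ∀ l → l < suc n → laplaceTerm n A l ≈ - laplaceTerm n B (swapℕ j l)
    term l l< with ℕ.<-cmp l j
    term l l< | tri< l<j _ _ = below j ≡.refl l<j
      where
      below : ∀ k → j ≡ k → l < k → laplaceTerm n A l ≈ - laplaceTerm n B (swapℕ j l)
      below (suc j′) ≡.refl (s≤s l≤j′) = fixed l (swapℕ-< j l (s≤s l≤j′))
        (detℕ-swapAdjacentColumns n j′ (minor l A) (minor l B) (ℕ.≤-pred jn)
          λ r c → A≈B (suc r) (punchInℕ l c) _ (swapℕ-punchInℕ-≤ j′ l c l≤j′))
    term l l< | tri≈ _ ≡.refl _ = exchanged j (suc j) (swapℕ-self j)
      (trans (sym (-‿involutive _)) (-‿cong (sym (sgn-suc j))))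
      (λ r c → A≈B (suc r) (punchInℕ j c) _ (swapℕ-punchInℕ-self j c))
    term l l< | tri> _ _ j<l with ℕ.<-cmp l (suc j)
    ... | tri< l<sj _ _ = ⊥-elim (ℕ.<-irrefl ≡.refl (ℕ.<-≤-trans l<sj j<l))
    ... | tri≈ _ ≡.refl _ = exchanged (suc j) j (swapℕ-suc j) (sgn-suc j)
      (λ r c → A≈B (suc r) (punchInℕ (suc j) c) _ (swapℕ-punchInℕ-suc j c))
    ... | tri> _ _ sj<l = fixed l (swapℕ-> j l sj<l)
      (detℕ-swapAdjacentColumns n j (minor l A) (minor l B) (ℕ.<-≤-trans sj<l (ℕ.≤-pred l<))
        λ r c → A≈B (suc r) (punchInℕ l c) _ (swapℕ-punchInℕ-≥ j l c sj<l))

  -- An adjacent swap shows that a determinant with two equal columns equals its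
  -- own negative, which forces it to vanish when 2 is not a zero divisor.
  module TwoTorsionFree (x+x≈0⇒x≈0 : ∀ x → x ⊕ x ≈ 0# → x ≈ 0#) where

    detℕ-equalAdjacentColumns : ∀ n j A → suc j < n → (∀ r → A r j ≈ A r (suc j)) → detℕ n A ≈ 0#
    detℕ-equalAdjacentColumns n j A jn h =
      x+x≈0⇒x≈0 _ (trans (+-cong refl (detℕ-swapAdjacentColumns n j A A jn A≈A∘swap)) (-‿inverseʳ _))
      where
      A≈A∘swap : ∀ r c → A r c ≈ A r (swapℕ j c)
      A≈A∘swap r c with ℕ.<-cmp c j
      ... | tri< c<j _ _ = reflexive (≡.cong (A r) (≡.sym (swapℕ-< j c c<j)))
      ... | tri≈ _ ≡.refl _ = trans (h r) (reflexive (≡.cong (A r) (≡.sym (swapℕ-self j))))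
      ... | tri> _ _ j<c with ℕ.<-cmp c (suc j)
      ...   | tri< c<sj _ _ = ⊥-elim (ℕ.<-irrefl ≡.refl (ℕ.<-≤-trans c<sj j<c))
      ...   | tri≈ _ ≡.refl _ = trans (sym (h r)) (reflexive (≡.cong (A r) (≡.sym (swapℕ-suc j))))
      ...   | tri> _ _ sj<c = reflexive (≡.cong (A r) (≡.sym (swapℕ-> j c sj<c)))

    detℕ-equalColumns : ∀ n j k A → j < k → k < n → (∀ r → A r j ≈ A r k) → detℕ n A ≈ 0#
    detℕ-equalColumns n j (suc k) A (s≤s j≤k) k<n h with ℕ.m≤n⇒m<n∨m≡n j≤k
    ... | inj₂ ≡.refl = detℕ-equalAdjacentColumns n j A k<n h
    ... | inj₁ j<k    = begin
      detℕ n A               ≈⟨ -‿involutive _ ⟨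
      - - detℕ n A           ≈⟨ -‿cong (detℕ-swapAdjacentColumns n k A′ A k<n λ _ _ → refl) ⟨
      - detℕ n A′            ≈⟨ -‿cong A′-singular ⟩
      - 0#                   ≈⟨ -0#≈0# ⟩
      0#                     ∎
      where
      A′ : Mat
      A′ r c = A r (swapℕ k c)
      A′-singular : detℕ n A′ ≈ 0#
      A′-singular = detℕ-equalColumns n j k A′ j<k (ℕ.<-trans (ℕ.n<1+n k) k<n) λ r → trans
        (reflexive (≡.cong (A r) (swapℕ-< k j j<k)))
        (trans (h r) (reflexive (≡.cong (A r) (≡.sym (swapℕ-self k)))))

    detℕ-addColumnMultiple : ∀ n j k A B a → j < k → k < n → (∀ r → A r k ≈ B r k ⊕ a * B r j)
      → (∀ r c → c ≢ k → A r c ≈ B r c) → detℕ n A ≈ detℕ n B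
    detℕ-addColumnMultiple n j k A B a j<k k< hk hoff = begin
      detℕ n A                   ≈⟨ detℕ-linearColumn n k A B C a k< column-k hoff off-k ⟩
      detℕ n B ⊕ a * detℕ n C    ≈⟨ +-cong refl (trans (*-cong refl C-singular) (zeroʳ a)) ⟩
      detℕ n B ⊕ 0#              ≈⟨ +-identityʳ _ ⟩
      detℕ n B                   ∎
      where
      C : Mat
      C = replaceColumn k (λ r → B r j) B
      column-k : ∀ r → A r k ≈ B r k ⊕ a * C r k
      column-k r = trans (hk r) (+-cong refl (*-cong refl (reflexive (≡.sym (replaceColumn-≡ k _ B r)))))
      off-k : ∀ r c → c ≢ k → A r c ≈ C r c
      off-k r c c≢k = trans (hoff r c c≢k) (reflexive (≡.sym (replaceColumn-≢ k _ B r c c≢k)))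
      C-singular : detℕ n C ≈ 0#
      C-singular = detℕ-equalColumns n j k C j<k k< λ r → reflexive
        (≡.trans (replaceColumn-≢ k _ B r j (ℕ.<⇒≢ j<k)) (≡.sym (replaceColumn-≡ k _ B r)))

    column+multipleOfColumn0 : Mat → (ℕ → Carrier) → ℕ → ℕ → Carrier
    column+multipleOfColumn0 B f c r = B r c ⊕ f c * B r 0

    addMultiplesOfColumn0 : Mat → (ℕ → Carrier) → ℕ → Mat
    addMultiplesOfColumn0 B f zero    = B
    addMultiplesOfColumn0 B f (suc t) =
      replaceColumn (suc t) (column+multipleOfColumn0 B f (suc t)) (addMultiplesOfColumn0 B f t)

    addMultiplesOfColumn0-0 : ∀ B f t r → addMultiplesOfColumn0 B f t r 0 ≡ B r 0
    addMultiplesOfColumn0-0 B f zero    r = ≡.refl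
    addMultiplesOfColumn0-0 B f (suc t) r =
      ≡.trans (replaceColumn-≢ (suc t) (column+multipleOfColumn0 B f (suc t)) (addMultiplesOfColumn0 B f t) r 0 λ ())
              (addMultiplesOfColumn0-0 B f t r)

    addMultiplesOfColumn0-> : ∀ B f t r c → t < c → addMultiplesOfColumn0 B f t r c ≡ B r c
    addMultiplesOfColumn0-> B f zero    r c _   = ≡.refl
    addMultiplesOfColumn0-> B f (suc t) r c t<c =
      ≡.trans (replaceColumn-≢ (suc t) _ _ r c (λ e → ℕ.<-irrefl (≡.sym e) t<c))
              (addMultiplesOfColumn0-> B f t r c (ℕ.<-trans (ℕ.n<1+n t) t<c))

    addMultiplesOfColumn0-≤ : ∀ B f t r c → 0 < c → c ≤ t →
      addMultiplesOfColumn0 B f t r c ≡ B r c ⊕ f c * B r 0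
    addMultiplesOfColumn0-≤ B f zero    r (suc c) _   ()
    addMultiplesOfColumn0-≤ B f (suc t) r c       0<c c≤ with c ≟ suc t
    ... | yes ≡.refl = ≡.refl
    ... | no  c≢st   = addMultiplesOfColumn0-≤ B f t r c 0<c (ℕ.≤-pred (ℕ.≤∧≢⇒< c≤ c≢st))

    detℕ-addMultiplesOfColumn0 : ∀ n B f t → t < n → detℕ n (addMultiplesOfColumn0 B f t) ≈ detℕ n B
    detℕ-addMultiplesOfColumn0 n B f zero    _  = refl
    detℕ-addMultiplesOfColumn0 n B f (suc t) t< = trans
      (detℕ-addColumnMultiple n 0 (suc t) _ (addMultiplesOfColumn0 B f t) (f (suc t)) (s≤s z≤n) t<
        (λ r → reflexive (≡.trans (replaceColumn-≡ (suc t) _ _ r)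
          (≡.cong₂ (λ u v → u ⊕ f (suc t) * v)
            (≡.sym (addMultiplesOfColumn0-> B f t r (suc t) (ℕ.n<1+n t)))
            (≡.sym (addMultiplesOfColumn0-0 B f t r)))))
        (λ r c c≢st → reflexive (replaceColumn-≢ (suc t) _ _ r c c≢st)))
      (detℕ-addMultiplesOfColumn0 n B f t (ℕ.<-trans (ℕ.n<1+n t) t<))

    -- Clearing row 0 with column operations: the Schur complement of the (0,0) entry.
    detℕ-pivot : ∀ n C f → (∀ c → c < n → C 0 (suc c) ≈ f (suc c) * C 0 0)
      → detℕ (suc n) C ≈ C 0 0 * detℕ n (λ r c → C (suc r) (suc c) ⊕ - (f (suc c) * C (suc r) 0))
    detℕ-pivot n C f hf = begin
      detℕ (suc n) C                                     ≈⟨ detℕ-cong< (suc n) C≈ ⟩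
      detℕ (suc n) (addMultiplesOfColumn0 Cleared f n)   ≈⟨ detℕ-addMultiplesOfColumn0 (suc n) Cleared f n (ℕ.n<1+n n) ⟩
      detℕ (suc n) Cleared                               ≈⟨ detℕ-row0-diagonal n Cleared (λ _ _ → refl) ⟩
      C 0 0 * detℕ n (λ r c → C (suc r) (suc c) ⊕ - (f (suc c) * C (suc r) 0)) ∎
      where
      Cleared : Mat
      Cleared r       zero    = C r 0
      Cleared zero    (suc c) = 0#
      Cleared (suc r) (suc c) = C (suc r) (suc c) ⊕ - (f (suc c) * C (suc r) 0)

      C≈Cleared+ : ∀ r c → 0 < c → c < suc n → C r c ≈ Cleared r c ⊕ f c * Cleared r 0
      C≈Cleared+ zero    (suc c) _ c< = trans (hf c (ℕ.≤-pred c<)) (sym (+-identityˡ _))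
      C≈Cleared+ (suc r) (suc c) _ _  = sym (trans (+-assoc _ _ _)
        (trans (+-cong refl (-‿inverseˡ _)) (+-identityʳ _)))

      C≈ : ∀ r c → r < suc n → c < suc n → C r c ≈ addMultiplesOfColumn0 Cleared f n r c
      C≈ r zero    _ _  = reflexive (≡.sym (addMultiplesOfColumn0-0 Cleared f n r))
      C≈ r (suc c) _ c< = trans (C≈Cleared+ r (suc c) (s≤s z≤n) c<)
        (reflexive (≡.sym (addMultiplesOfColumn0-≤ Cleared f n r (suc c) (s≤s z≤n) (ℕ.≤-pred c<))))

module SeidelCharacteristicMatrices where

  open import Data.Bool using (Bool; true; false; not; T; _∧_; _∨_; if_then_else_)
  open import Data.Bool.Properties using (T-∧; T-≡; ∨-identityʳ)
  import Data.Integer as ℤ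
  open import Data.List using ([]; _∷_)
  open import Data.Maybe using (Maybe; just; nothing)
  open import Data.Nat using (zero; suc; _<_; _≡ᵇ_; _⊔_; _≟_) renaming (_+_ to _+ℕ_)
  import Data.Nat.Properties as ℕ
  open import Data.Product using (_,_)
  open import Data.Unit using (tt)
  open import Function.Bundles using (module Equivalence)
  open import Relation.Binary.PropositionalEquality as ≡ using (_≡_; _≢_; ≢-sym)
  open import Data.Empty using (⊥-elim)
  open import Relation.Nullary.Decidable using (isYes; toWitness; T?; yes; no)
  open import Tactic.RingSolver.Core.AlmostCommutativeRing using (AlmostCommutativeRing; fromCommutativeRing)
  open import Level using (0ℓ)
  open IndexArithmetic using (≡ᵇ-refl; ≡ᵇ-≢)
  open PolynomialRing
  open CommutativeRing polyRing
    using (_+_; _*_; -_; 0#; 1#; +-cong; *-cong; -‿cong; *-assoc; *-identityˡ; refl; sym; trans; reflexive; setoid)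
  open Determinant polyRing
  open TwoTorsionFree p+p≃0⇒p≃0
  open import Relation.Binary.Reasoning.Setoid setoid

  infix 4 _≃ᵇ_
  _≃ᵇ_ : Poly → Poly → Bool
  []      ≃ᵇ []      = true
  (a ∷ p) ≃ᵇ []      = isYes (a ℤ.≟ ℤ.0ℤ) ∧ (p ≃ᵇ [])
  []      ≃ᵇ (b ∷ q) = isYes (ℤ.0ℤ ℤ.≟ b) ∧ ([] ≃ᵇ q)
  (a ∷ p) ≃ᵇ (b ∷ q) = isYes (a ℤ.≟ b) ∧ (p ≃ᵇ q)

  [0]≃[] : (ℤ.0ℤ ∷ []) ≃ []
  [0]≃[] = coeffwise λ { zero → ≡.refl ; (suc _) → ≡.refl }

  ≃ᵇ-sound : ∀ p q → T (p ≃ᵇ q) → p ≃ q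
  ≃ᵇ-sound []      []      _ = ≃-refl
  ≃ᵇ-sound (a ∷ p) []      h with Equivalence.to T-∧ h
  ... | a≡0 , p≃[] = ≃-trans (∷-cong (toWitness a≡0) (≃ᵇ-sound p [] p≃[])) [0]≃[]
  ≃ᵇ-sound []      (b ∷ q) h with Equivalence.to T-∧ h
  ... | 0≡b , []≃q = ≃-trans (≃-sym [0]≃[]) (∷-cong (toWitness 0≡b) (≃ᵇ-sound [] q []≃q))
  ≃ᵇ-sound (a ∷ p) (b ∷ q) h with Equivalence.to T-∧ h
  ... | a≡b , p≃q = ∷-cong (toWitness a≡b) (≃ᵇ-sound p q p≃q)

  by-evaluation : ∀ {p q} → T (p ≃ᵇ q) → p ≃ q
  by-evaluation {p} {q} = ≃ᵇ-sound p q

  polyACR : AlmostCommutativeRing 0ℓ 0ℓ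
  polyACR = fromCommutativeRing polyRing isZero?
    where
    isZero? : (p : Poly) → Maybe ([] ≃ p)
    isZero? p with T? ([] ≃ᵇ p)
    ... | yes h = just (≃ᵇ-sound [] p h)
    ... | no  _ = nothing

  open import Tactic.RingSolver.NonReflective polyACR

  y : Poly
  y = Xₚ +ₚ constₚ ℤ.1ℤ

  y^_ : ℕ → Poly
  y^ zero  = 1#
  y^ suc k = y * y^ k

  -- ⌜ m +ℕ k ⌝ is definitionally ⌜ m ⌝ + ⌜ k ⌝; the ring solver calls below use
  -- this to treat ⌜ m +ℕ k ⌝ as the constant ⌜ m ⌝ plus the variable ⌜ k ⌝.
  ⌜_⌝ : ℕ → Poly
  ⌜ k ⌝ = constₚ (ℤ.+ k)

  -- Entries of x I − S = y I − J + 2 A.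
  charEntry : (diagonal adjacent : Bool) → Poly
  charEntry true  _     = y + - 1#
  charEntry false true  = 1#
  charEntry false false = - 1#

  charMat : (ℕ → ℕ → Bool) → Mat
  charMat adj r c = charEntry (r ≡ᵇ c) (adj r c)

  charEntry-diagonal : ∀ r a b → charEntry (r ≡ᵇ r) a ≡ charEntry (r ≡ᵇ r) b
  charEntry-diagonal r a b rewrite ≡ᵇ-refl r = ≡.refl

  charEntry-offDiagonal : ∀ r c a → r ≢ c → charEntry (r ≡ᵇ c) a ≡ charEntry false a
  charEntry-offDiagonal r c a r≢c = ≡.cong (λ d → charEntry d a) (≡ᵇ-≢ r c r≢c)

  threshold : (ℕ → Bool) → ℕ → ℕ → Bool
  threshold α r c = α (r ⊔ c)

  yI : Mat
  yI r c = if r ≡ᵇ c then y else 0#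

  yI-aJ : Poly → Mat
  yI-aJ a r c = if r ≡ᵇ c then y + - a else - a

  yI+aA : Poly → (ℕ → ℕ → Bool) → Mat
  yI+aA a adj r c = if r ≡ᵇ c then y else if adj r c then a else 0#

  detℕ-yI : ∀ k → detℕ k yI ≃ y^ k
  detℕ-yI zero    = refl
  detℕ-yI (suc k) = trans (detℕ-row0-diagonal k yI (λ _ _ → refl)) (*-cong (refl {y}) (detℕ-yI k))

  detℕ-yI-aJ : ∀ a k → detℕ (suc k) (yI-aJ a) ≃ y^ k * (y + - (a * ⌜ suc k ⌝))
  detℕ-yI-aJ a zero    = trans (detℕ-1 (yI-aJ a))
    (solve 2 (λ y a → (y ⊕ ⊝ a) ⊜ (Κ 1# ⊗ (y ⊕ ⊝ (a ⊗ Κ 1#)))) ≃-refl y a)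
  detℕ-yI-aJ a (suc k) = begin
    detℕ (suc (suc k)) (yI-aJ a)                  ≈⟨ expand-row0 ⟩
    y * detℕ (suc k) (yI-aJ a) + - (a * y^ suc k)  ≈⟨ +-cong (*-cong (refl {y}) (detℕ-yI-aJ a k)) (refl { - (a * y^ suc k) }) ⟩
    y * (y^ k * (y + - (a * ⌜ suc k ⌝))) + - (a * (y * y^ k))
      ≈⟨ solve 4 (λ y a p K → (y ⊗ (p ⊗ (y ⊕ ⊝ (a ⊗ K))) ⊕ ⊝ (a ⊗ (y ⊗ p)))
                            ⊜ ((y ⊗ p) ⊗ (y ⊕ ⊝ (a ⊗ (Κ 1# ⊕ K)))))
               ≃-refl y a (y^ k) ⌜ suc k ⌝ ⟩
    y^ suc k * (y + - (a * ⌜ suc (suc k) ⌝))       ∎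
    where
    M : Mat
    M = yI-aJ a
    -- row 0 = (y, 0, …, 0) + a (−1, …, −1); the second part pivots to y I
    row0 : ∀ c → M 0 c ≃ unitRow y c + a * - 1#
    row0 zero    = solve 2 (λ y a → (y ⊕ ⊝ a) ⊜ (y ⊕ a ⊗ ⊝ Κ 1#)) ≃-refl y a
    row0 (suc c) = solve 1 (λ a → ⊝ a ⊜ (Κ 0# ⊕ a ⊗ ⊝ Κ 1#)) ≃-refl a
    pivoted : ∀ r c → M (suc r) (suc c) + - (1# * - a) ≃ yI r c
    pivoted r c with r ≡ᵇ c
    ... | true  = solve 2 (λ y a → ((y ⊕ ⊝ a) ⊕ ⊝ (Κ 1# ⊗ ⊝ a)) ⊜ y) ≃-refl y a
    ... | false = solve 1 (λ a → (⊝ a ⊕ ⊝ (Κ 1# ⊗ ⊝ a)) ⊜ Κ 0#) ≃-refl a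
    expand-row0 : detℕ (suc (suc k)) M ≃ y * detℕ (suc k) M + - (a * y^ suc k)
    expand-row0 = begin
      detℕ (suc (suc k)) M
        ≈⟨ detℕ-linearRow0 (suc k) M (unitRow y) (λ _ → - 1#) a row0 ⟩
      detℕ (suc (suc k)) (withRow0 (unitRow y) M) + a * detℕ (suc (suc k)) (withRow0 (λ _ → - 1#) M)
        ≈⟨ +-cong (detℕ-unitRow0 (suc k) y M)
                  (*-cong (refl {a}) (detℕ-pivot (suc k) (withRow0 (λ _ → - 1#) M) (λ _ → 1#) λ _ _ → sym (*-identityˡ _))) ⟩
      y * detℕ (suc k) M + a * (- 1# * detℕ (suc k) (λ r c → M (suc (suc r)) (suc (suc c)) + - (1# * - a)))
        ≈⟨ +-cong (refl {y * detℕ (suc k) M})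
                  (*-cong (refl {a}) (*-cong (refl { - 1# }) (trans (detℕ-cong (suc k) pivoted) (detℕ-yI (suc k))))) ⟩
      y * detℕ (suc k) M + a * (- 1# * y^ suc k)
        ≈⟨ +-cong (refl {y * detℕ (suc k) M}) (solve 2 (λ a p → (a ⊗ (⊝ Κ 1# ⊗ p)) ⊜ (⊝ (a ⊗ p))) ≃-refl a (y^ suc k)) ⟩
      y * detℕ (suc k) M + - (a * y^ suc k) ∎

  detℕ-charMat-peel : ∀ n adj → detℕ (suc n) (charMat adj) ≃
    y * detℕ n (λ r c → charMat adj (suc r) (suc c))
    + - detℕ n (λ r c → charMat adj (suc r) (suc c) + charMat adj 0 (suc c) * charMat adj (suc r) 0)
  detℕ-charMat-peel n adj = begin
    detℕ (suc n) M
      ≈⟨ detℕ-linearRow0 n M (unitRow y) v 1# row0 ⟩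
    detℕ (suc n) (withRow0 (unitRow y) M) + 1# * detℕ (suc n) (withRow0 v M)
      ≈⟨ +-cong (detℕ-unitRow0 n y M) (*-cong (refl {1#}) (detℕ-pivot n (withRow0 v M) (λ c → - v c) λ c _ →
           solve 1 (λ m → m ⊜ (⊝ m ⊗ ⊝ Κ 1#)) ≃-refl (M 0 (suc c)))) ⟩
    y * detℕ n M⁺ + 1# * (- 1# * detℕ n (λ r c → M (suc r) (suc c) + - (- M 0 (suc c) * M (suc r) 0)))
      ≈⟨ +-cong (refl {y * detℕ n M⁺}) (trans (*-cong (refl {1#}) (*-cong (refl { - 1# }) (detℕ-cong n λ r c →
           solve 3 (λ m s t → (m ⊕ ⊝ (⊝ s ⊗ t)) ⊜ (m ⊕ s ⊗ t)) ≃-refl (M (suc r) (suc c)) (M 0 (suc c)) (M (suc r) 0))))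
           (solve 1 (λ d → (Κ 1# ⊗ (⊝ Κ 1# ⊗ d)) ⊜ (⊝ d)) ≃-refl _)) ⟩
    y * detℕ n M⁺ + - detℕ n (λ r c → M (suc r) (suc c) + M 0 (suc c) * M (suc r) 0)   ∎
    where
    M M⁺ : Mat
    M = charMat adj
    M⁺ r c = M (suc r) (suc c)
    v : ℕ → Poly
    v zero    = - 1#
    v (suc c) = M 0 (suc c)
    row0 : ∀ c → M 0 c ≃ unitRow y c + 1# * v c
    row0 zero    = by-evaluation tt
    row0 (suc c) = solve 1 (λ m → m ⊜ (Κ 0# ⊕ Κ 1# ⊗ m)) ≃-refl (M 0 (suc c))

  peeledThreshold : (ℕ → Bool) → Mat
  peeledThreshold α r c = if r ≡ᵇ c then y else
    charEntry false (α (suc (r ⊔ c))) + charEntry false (α (suc c)) * charEntry false (α (suc r))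

  detℕ-threshold-peel : ∀ n α → detℕ (suc n) (charMat (threshold α)) ≃
    y * detℕ n (charMat (threshold (λ v → α (suc v)))) + - detℕ n (peeledThreshold α)
  detℕ-threshold-peel n α =
    trans (detℕ-charMat-peel n (threshold α)) (+-cong refl (-‿cong (detℕ-cong n entry)))
    where
    entry : ∀ r c → charMat (threshold α) (suc r) (suc c)
                    + charMat (threshold α) 0 (suc c) * charMat (threshold α) (suc r) 0
                    ≃ peeledThreshold α r c
    entry r c with r ≡ᵇ c in r≡ᵇc
    ... | false = refl
    ... | true rewrite ℕ.≡ᵇ⇒≡ r c (Equivalence.from T-≡ r≡ᵇc) = diagonal (α (suc c))
      where
      diagonal : ∀ s → charEntry true (α (suc (c ⊔ c))) + charEntry false s * charEntry false s ≃ y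
      diagonal true  = by-evaluation tt
      diagonal false = by-evaluation tt

  -- k ≤ᵇ_, recursing on both arguments so that atLeast (suc k) (suc v) reduces to
  -- atLeast k v: peeling vertex 0 then shifts the string definitionally.
  atLeast : ℕ → ℕ → Bool
  atLeast zero    _       = true
  atLeast (suc k) zero    = false
  atLeast (suc k) (suc v) = atLeast k v

  atLeast-⊔ : ∀ k r c → atLeast k (r ⊔ c) ≡ atLeast k r ∨ atLeast k c
  atLeast-⊔ zero    r       c       = ≡.refl
  atLeast-⊔ (suc k) zero    c       = ≡.refl
  atLeast-⊔ (suc k) (suc r) zero    = ≡.sym (∨-identityʳ (atLeast k r))
  atLeast-⊔ (suc k) (suc r) (suc c) = atLeast-⊔ k r c

  clique : (ℕ → Bool) → ℕ → ℕ → Bool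
  clique α r c = α r ∧ α c

  detℕ-yI+aA-edge : ∀ a k → detℕ (suc (suc k)) (yI+aA a (clique (atLeast k))) ≃ y^ k * (y * y + - (a * a))
  detℕ-yI+aA-edge a zero    = trans (detℕ-2 (yI+aA a (clique (atLeast 0))))
    (solve 2 (λ y a → (y ⊗ y ⊕ ⊝ (a ⊗ a)) ⊜ (Κ 1# ⊗ (y ⊗ y ⊕ ⊝ (a ⊗ a)))) ≃-refl y a)
  detℕ-yI+aA-edge a (suc k) = begin
    detℕ (suc (suc (suc k))) (yI+aA a (clique (atLeast (suc k))))
      ≈⟨ detℕ-row0-diagonal (suc (suc k)) (yI+aA a (clique (atLeast (suc k)))) (λ _ _ → refl) ⟩
    y * detℕ (suc (suc k)) (yI+aA a (clique (atLeast k)))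
      ≈⟨ *-cong (refl {y}) (detℕ-yI+aA-edge a k) ⟩
    y * (y^ k * (y * y + - (a * a)))
      ≈⟨ sym (*-assoc y (y^ k) (y * y + - (a * a))) ⟩
    y^ suc k * (y * y + - (a * a)) ∎

  -- y^(n − 3) (y³ − n y² + 4 (n − 2)) for n = k + 3
  Φ : ℕ → Poly
  Φ k = y^ k * (y * y * y + - (⌜ 3 +ℕ k ⌝ * (y * y)) + ⌜ 4 ⌝ * ⌜ 1 +ℕ k ⌝)

  detℕ-lastTwoDominating : ∀ k → detℕ (3 +ℕ k) (charMat (threshold (atLeast (suc k)))) ≃ Φ k
  detℕ-lastTwoDominating zero    = by-evaluation tt
  detℕ-lastTwoDominating (suc k) = begin
    detℕ (4 +ℕ k) (charMat (threshold (atLeast (2 +ℕ k))))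
      ≈⟨ detℕ-threshold-peel (3 +ℕ k) (atLeast (2 +ℕ k)) ⟩
    y * detℕ (3 +ℕ k) (charMat (threshold (atLeast (suc k)))) + - detℕ (3 +ℕ k) (peeledThreshold (atLeast (2 +ℕ k)))
      ≈⟨ +-cong (*-cong (refl {y}) (detℕ-lastTwoDominating k))
                (-‿cong (trans (detℕ-cong (3 +ℕ k) peeled) (detℕ-yI+aA-edge ⌜ 2 ⌝ (suc k)))) ⟩
    y * Φ k + - (y^ suc k * (y * y + - (⌜ 2 ⌝ * ⌜ 2 ⌝)))
      ≈⟨ solve 3 (λ y p K →
           (y ⊗ (p ⊗ (y ⊗ y ⊗ y ⊕ ⊝ ((Κ ⌜ 3 ⌝ ⊕ K) ⊗ (y ⊗ y)) ⊕ Κ ⌜ 4 ⌝ ⊗ (Κ 1# ⊕ K)))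
             ⊕ ⊝ ((y ⊗ p) ⊗ (y ⊗ y ⊕ ⊝ (Κ ⌜ 2 ⌝ ⊗ Κ ⌜ 2 ⌝))))
           ⊜ ((y ⊗ p) ⊗ (y ⊗ y ⊗ y ⊕ ⊝ ((Κ ⌜ 4 ⌝ ⊕ K) ⊗ (y ⊗ y)) ⊕ Κ ⌜ 4 ⌝ ⊗ (Κ ⌜ 2 ⌝ ⊕ K))))
           ≃-refl y (y^ k) ⌜ k ⌝ ⟩
    Φ (suc k) ∎
    where
    peeled : ∀ r c → peeledThreshold (atLeast (2 +ℕ k)) r c ≃ yI+aA ⌜ 2 ⌝ (clique (atLeast (suc k))) r c
    peeled r c with r ≡ᵇ c
    ... | true  = refl
    ... | false rewrite atLeast-⊔ (suc k) r c with atLeast (suc k) r | atLeast (suc k) c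
    ...   | true  | true  = by-evaluation tt
    ...   | true  | false = by-evaluation tt
    ...   | false | true  = by-evaluation tt
    ...   | false | false = by-evaluation tt

  star : ℕ → ℕ → Bool
  star r c = (r ≡ᵇ 0) ∨ (c ≡ᵇ 0)

  -- Row 0 is (y + 1) e₀ + (−1, a, …, a), and the second part pivots to y I + a² J.
  detℕ-yI+aA-star : ∀ a k → detℕ (suc (suc k)) (yI+aA a star) ≃ y^ k * (y * y + - (a * a * ⌜ suc k ⌝))
  detℕ-yI+aA-star a k = begin
    detℕ (suc (suc k)) M
      ≈⟨ detℕ-linearRow0 (suc k) M (unitRow (y + 1#)) v 1# row0 ⟩
    detℕ (suc (suc k)) (withRow0 (unitRow (y + 1#)) M) + 1# * detℕ (suc (suc k)) (withRow0 v M)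
      ≈⟨ +-cong (detℕ-unitRow0 (suc k) (y + 1#) M) (*-cong (refl {1#})
           (detℕ-pivot (suc k) (withRow0 v M) (λ _ → - a) λ _ _ → solve 1 (λ a → a ⊜ (⊝ a ⊗ ⊝ Κ 1#)) ≃-refl a)) ⟩
    (y + 1#) * detℕ (suc k) yI + 1# * (- 1# * detℕ (suc k) (λ r c → M (suc (suc r)) (suc (suc c)) + - (- a * a)))
      ≈⟨ +-cong (*-cong (refl {y + 1#}) (detℕ-yI (suc k)))
                (*-cong (refl {1#}) (*-cong (refl { - 1# }) (trans (detℕ-cong (suc k) pivoted) (detℕ-yI-aJ (- (a * a)) k)))) ⟩
    (y + 1#) * y^ suc k + 1# * (- 1# * (y^ k * (y + - (- (a * a) * ⌜ suc k ⌝))))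
      ≈⟨ solve 4 (λ y a p K → ((y ⊕ Κ 1#) ⊗ (y ⊗ p) ⊕ Κ 1# ⊗ (⊝ Κ 1# ⊗ (p ⊗ (y ⊕ ⊝ (⊝ (a ⊗ a) ⊗ K)))))
                              ⊜ (p ⊗ (y ⊗ y ⊕ ⊝ (a ⊗ a ⊗ K))))
               ≃-refl y a (y^ k) ⌜ suc k ⌝ ⟩
    y^ k * (y * y + - (a * a * ⌜ suc k ⌝)) ∎
    where
    M : Mat
    M = yI+aA a star
    v : ℕ → Poly
    v zero    = - 1#
    v (suc _) = a
    row0 : ∀ c → M 0 c ≃ unitRow (y + 1#) c + 1# * v c
    row0 zero    = solve 1 (λ y → y ⊜ ((y ⊕ Κ 1#) ⊕ Κ 1# ⊗ ⊝ Κ 1#)) ≃-refl y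
    row0 (suc _) = solve 1 (λ a → a ⊜ (Κ 0# ⊕ Κ 1# ⊗ a)) ≃-refl a
    pivoted : ∀ r c → M (suc (suc r)) (suc (suc c)) + - (- a * a) ≃ yI-aJ (- (a * a)) r c
    pivoted r c with r ≡ᵇ c
    ... | true  = solve 2 (λ y a → (y ⊕ ⊝ (⊝ a ⊗ a)) ⊜ (y ⊕ ⊝ (⊝ (a ⊗ a)))) ≃-refl y a
    ... | false = solve 1 (λ a → (Κ 0# ⊕ ⊝ (⊝ a ⊗ a)) ⊜ (⊝ (⊝ (a ⊗ a)))) ≃-refl a

  edge01 : ℕ → Bool
  edge01 v = v ≡ᵇ 1

  detℕ-singleEdge : ∀ k → detℕ (3 +ℕ k) (charMat (threshold edge01)) ≃ Φ k
  detℕ-singleEdge k = begin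
    detℕ (3 +ℕ k) (charMat (threshold edge01))
      ≈⟨ detℕ-threshold-peel (2 +ℕ k) edge01 ⟩
    y * detℕ (2 +ℕ k) (charMat (threshold (λ v → v ≡ᵇ 0))) + - detℕ (2 +ℕ k) (peeledThreshold edge01)
      ≈⟨ +-cong (*-cong (refl {y}) (trans (detℕ-cong (2 +ℕ k) edgeless) (detℕ-yI-aJ 1# (suc k))))
                (-‿cong (trans (detℕ-cong (2 +ℕ k) peeled) (detℕ-yI+aA-star (- ⌜ 2 ⌝) k))) ⟩
    y * (y^ suc k * (y + - (1# * ⌜ 2 +ℕ k ⌝))) + - (y^ k * (y * y + - (- ⌜ 2 ⌝ * - ⌜ 2 ⌝ * ⌜ 1 +ℕ k ⌝)))
      ≈⟨ solve 3 (λ y p K →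
           (y ⊗ ((y ⊗ p) ⊗ (y ⊕ ⊝ (Κ 1# ⊗ (Κ ⌜ 2 ⌝ ⊕ K))))
             ⊕ ⊝ (p ⊗ (y ⊗ y ⊕ ⊝ (⊝ Κ ⌜ 2 ⌝ ⊗ ⊝ Κ ⌜ 2 ⌝ ⊗ (Κ 1# ⊕ K)))))
           ⊜ (p ⊗ (y ⊗ y ⊗ y ⊕ ⊝ ((Κ ⌜ 3 ⌝ ⊕ K) ⊗ (y ⊗ y)) ⊕ Κ ⌜ 4 ⌝ ⊗ (Κ 1# ⊕ K))))
           ≃-refl y (y^ k) ⌜ k ⌝ ⟩
    Φ k ∎
    where
    edgeless : ∀ r c → charMat (threshold (λ v → v ≡ᵇ 0)) r c ≃ yI-aJ 1# r c
    edgeless zero    zero    = refl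
    edgeless zero    (suc c) = refl
    edgeless (suc r) zero    = refl
    edgeless (suc r) (suc c) with r ≡ᵇ c
    ... | true  = refl
    ... | false = refl
    peeled : ∀ r c → peeledThreshold edge01 r c ≃ yI+aA (- ⌜ 2 ⌝) star r c
    peeled zero    zero    = refl
    peeled zero    (suc c) = by-evaluation tt
    peeled (suc r) zero    = by-evaluation tt
    peeled (suc r) (suc c) with r ≡ᵇ c
    ... | true  = refl
    ... | false = by-evaluation tt

  -- Switching at the last vertex q flips the bit of q in the binary string.
  detℕ-threshold-switchLast : ∀ q α β → (∀ v → v < q → α v ≡ β v) → β q ≡ not (α q) →
    detℕ (suc q) (charMat (threshold α)) ≃ detℕ (suc q) (charMat (threshold β))
  detℕ-threshold-switchLast q α β below last =
    trans (sym (detℕ-switch (suc q) q (charMat (threshold α)) (ℕ.n<1+n q))) (detℕ-cong< (suc q) entry)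
    where
    flip : ∀ b → - charEntry false b ≃ charEntry false (not b)
    flip true  = by-evaluation tt
    flip false = by-evaluation tt

    entry : ∀ r c → r < suc q → c < suc q → switch q (charMat (threshold α)) r c ≃ charMat (threshold β) r c
    entry r c r< c< with r ≟ q | c ≟ q
    ... | yes ≡.refl | yes ≡.refl = reflexive (charEntry-diagonal q _ _)
    ... | yes ≡.refl | no c≢q
      rewrite ℕ.m≥n⇒m⊔n≡m (ℕ.≤-pred c<) | charEntry-offDiagonal q c (α q) (≢-sym c≢q)
            | charEntry-offDiagonal q c (β q) (≢-sym c≢q) | last = flip (α q)
    ... | no r≢q     | yes ≡.refl
      rewrite ℕ.m≤n⇒m⊔n≡n (ℕ.≤-pred r<) | charEntry-offDiagonal r q (α q) r≢q
            | charEntry-offDiagonal r q (β q) r≢q | last = flip (α q)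
    ... | no r≢q     | no c≢q     = reflexive (≡.cong (charEntry (r ≡ᵇ c)) (below (r ⊔ c)
      (ℕ.⊔-pres-<m (ℕ.≤∧≢⇒< (ℕ.≤-pred r<) r≢q) (ℕ.≤∧≢⇒< (ℕ.≤-pred c<) c≢q))))

module FinMatrices where

  open import Data.Bool using (Bool; true; false; if_then_else_)
  open import Data.Fin using (Fin; zero; suc; toℕ; punchIn)
  import Data.Integer as ℤ
  open import Data.Nat using (zero; suc; _≡ᵇ_; _<ᵇ_)
  open import Data.Unit using (tt)
  open import Relation.Binary.PropositionalEquality as ≡ using (_≡_)
  open IndexArithmetic using (punchInℕ)
  open PolynomialRing
  open Determinant polyRing
  open SeidelCharacteristicMatrices

  toℕ-punchIn : ∀ {n} (j : Fin (suc n)) (c : Fin n) → toℕ (punchIn j c) ≡ punchInℕ (toℕ j) (toℕ c)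
  toℕ-punchIn zero    c       = ≡.refl
  toℕ-punchIn (suc j) zero    = ≡.refl
  toℕ-punchIn (suc j) (suc c) = ≡.cong suc (toℕ-punchIn j c)

  sign≃sgn : ∀ k → sign k ≃ sgn k
  sign≃sgn zero          = ≃-refl
  sign≃sgn (suc zero)    = by-evaluation tt
  sign≃sgn (suc (suc k)) = sign≃sgn k

  sumFin≃∑ : ∀ n (f : Fin n → Poly) (g : ℕ → Poly) → (∀ j → f j ≃ g (toℕ j)) → sumFin f ≃ ∑ n g
  sumFin≃∑ zero    f g h = ≃-refl
  sumFin≃∑ (suc n) f g h = +ₚ-cong (h zero) (sumFin≃∑ n (λ j → f (suc j)) (λ j → g (suc j)) (λ j → h (suc j)))

  det≃detℕ : ∀ n (M : Matrix Poly n) (M′ : Mat) → (∀ i j → M i j ≃ M′ (toℕ i) (toℕ j)) → det M ≃ detℕ n M′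
  det≃detℕ zero    M M′ h = ≃-refl
  det≃detℕ (suc n) M M′ h = sumFin≃∑ (suc n) _ (laplaceTerm n M′) λ j →
    *ₚ-cong (*ₚ-cong (sign≃sgn (toℕ j)) (h zero j))
            (det≃detℕ n _ (minor (toℕ j) M′) λ r c →
              ≃-trans (h (suc r) (punchIn j c)) (≃-reflexive (≡.cong (M′ (suc (toℕ r))) (toℕ-punchIn j c))))

  δ≡ : ∀ {n} (i j : Fin n) → δ i j ≡ (if toℕ i ≡ᵇ toℕ j then ℤ.1ℤ else ℤ.0ℤ)
  δ≡ zero    zero    = ≡.refl
  δ≡ zero    (suc j) = ≡.refl
  δ≡ (suc i) zero    = ≡.refl
  δ≡ (suc i) (suc j) = δ≡ i j

  -- The (r, c) entry of the matrix in charPoly (seidel (thresholdAdj α)) when α = β ∘ toℕ.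
  seidelCharEntry : (ℕ → Bool) → ℕ → ℕ → Poly
  seidelCharEntry β r c =
    scaleₚ (if r ≡ᵇ c then ℤ.1ℤ else ℤ.0ℤ) Xₚ
    +ₚ constₚ (ℤ.- ((ℤ.1ℤ ℤ.- (if r ≡ᵇ c then ℤ.1ℤ else ℤ.0ℤ)) ℤ.- ℤ.+ 2 ℤ.*
         (if r <ᵇ c then (if β c then ℤ.1ℤ else ℤ.0ℤ)
          else if c <ᵇ r then (if β r then ℤ.1ℤ else ℤ.0ℤ) else ℤ.0ℤ)))

  seidelCharEntry≃charMat : ∀ β r c → seidelCharEntry β r c ≃ charMat (threshold β) r c
  seidelCharEntry≃charMat β zero    zero    = by-evaluation tt
  seidelCharEntry≃charMat β zero    (suc c) with β (suc c)
  ... | true  = by-evaluation tt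
  ... | false = by-evaluation tt
  seidelCharEntry≃charMat β (suc r) zero    with β (suc r)
  ... | true  = by-evaluation tt
  ... | false = by-evaluation tt
  seidelCharEntry≃charMat β (suc r) (suc c) = seidelCharEntry≃charMat (λ v → β (suc v)) r c

  charPoly-threshold : ∀ n β →
    charPoly (seidel (thresholdAdj {n} (λ i → β (toℕ i)))) ≃ detℕ n (charMat (threshold β))
  charPoly-threshold n β = det≃detℕ n _ (charMat (threshold β)) entry
    where
    entry : ∀ i j → scaleₚ (δ i j) Xₚ +ₚ constₚ (ℤ.- seidel (thresholdAdj (λ i → β (toℕ i))) i j)
                    ≃ charMat (threshold β) (toℕ i) (toℕ j)
    entry i j rewrite δ≡ i j = seidelCharEntry≃charMat β (toℕ i) (toℕ j)

open import Data.Bool using (Bool; not; _∨_)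
open import Data.Bool.Properties using (∨-identityʳ)
open import Data.Fin using (toℕ)
open import Data.Nat using (zero; suc; s≤s; _<_; _≤ᵇ_; _≡ᵇ_; _⊔_)
open import Data.Nat.Properties using (<⇒≢)
open import Relation.Binary.PropositionalEquality using (_≡_; refl; cong; sym)
open IndexArithmetic using (≡ᵇ-refl; ≡ᵇ-≢)
open PolynomialRing
open Determinant polyRing using (detℕ; detℕ-cong)
open SeidelCharacteristicMatrices
open FinMatrices using (charPoly-threshold)
open import Relation.Binary.Reasoning.Setoid (CommutativeRing.setoid polyRing)

atLeast≡≤ᵇ : ∀ k v → atLeast k v ≡ (k ≤ᵇ v)
atLeast≡≤ᵇ zero          v       = refl
atLeast≡≤ᵇ (suc k)       zero    = refl
atLeast≡≤ᵇ (suc zero)    (suc v) = refl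
atLeast≡≤ᵇ (suc (suc k)) (suc v) = atLeast≡≤ᵇ (suc k) v

detℕ-b₁ : ∀ m → detℕ (suc (suc (suc m))) (charMat (threshold (suc m ≤ᵇ_))) ≃ Φ m
detℕ-b₁ m = ≃-trans
  (detℕ-cong (suc (suc (suc m))) λ r c → ≃-reflexive (cong (charEntry (r ≡ᵇ c)) (sym (atLeast≡≤ᵇ (suc m) (r ⊔ c)))))
  (detℕ-lastTwoDominating m)

-- Switching at the last vertex q turns the string 0 1 0 ⋯ 0 1 into 0 1 0 ⋯ 0 0.
detℕ-b₂ : ∀ m → detℕ (suc (suc (suc m))) (charMat (threshold λ v → (v ≡ᵇ 1) ∨ (v ≡ᵇ suc (suc m)))) ≃ Φ m
detℕ-b₂ m = ≃-trans (detℕ-threshold-switchLast q _ edge01 below last) (detℕ-singleEdge m)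
  where
  q : ℕ
  q = suc (suc m)
  below : ∀ v → v < q → (v ≡ᵇ 1) ∨ (v ≡ᵇ q) ≡ edge01 v
  below v v<q rewrite ≡ᵇ-≢ v q (<⇒≢ v<q) = ∨-identityʳ (v ≡ᵇ 1)
  last : edge01 q ≡ not ((q ≡ᵇ 1) ∨ (q ≡ᵇ q))
  last rewrite ≡ᵇ-refl q = refl

mainTheorem12 : (n : ℕ) → 3 ≤ n →
    SeidelCospectral (thresholdAdj (b₁ n)) (thresholdAdj (b₂ n))
mainTheorem12 (suc (suc (suc m))) _ = coeff-≡ (begin
  charPoly (seidel (thresholdAdj (b₁ n)))   ≈⟨ charPoly-threshold n β₁ ⟩
  detℕ n (charMat (threshold β₁))           ≈⟨ detℕ-b₁ m ⟩
  Φ m                                       ≈⟨ detℕ-b₂ m ⟨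
  detℕ n (charMat (threshold β₂))           ≈⟨ charPoly-threshold n β₂ ⟨
  charPoly (seidel (thresholdAdj (b₂ n)))   ∎)
  where
  n : ℕ
  n = suc (suc (suc m))
  β₁ β₂ : ℕ → Bool
  β₁ v = suc m ≤ᵇ v
  β₂ v = (v ≡ᵇ 1) ∨ (v ≡ᵇ suc (suc m))
mainTheorem12 (suc zero)       (s≤s ())
mainTheorem12 (suc (suc zero)) (s≤s (s≤s ()))
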